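{- Let $k\ge 3$ and $n$ be integers with $n-k\ge 1$, and let $G=L_c(S(CS_{k,n-k}))$ be the line cut-vertex graph of the subdivision graph of the cycle-star graph $CS_{k,n-k}$. Then $$\overline{M_1}(G)=2n^3+(22-4k)n^2+(2k^2-10k-28)n-4k^2+28k-14.$$
   Context: All graphs are finite and simple; $d_G(v)$ denotes the degree of vertex $v$ in $G$. The cycle-star graph $CS_{k,n-k}$ is the graph on $n$ vertices consisting of a cycle of length $k$ together with $n-k$ leaf (pendant) vertices, all attached to the same vertex of the cycle. The subdivision graph $S(H)$ of a graph $H$ is obtained by replacing each edge of $H$ by a path of length 2. The line cut-vertex graph $L_c(H)$ of a graph $H$ is the graph whose vertices are the edges and the cut-vertices of $H$, two vertices being adjacent iff either they are edges of $H$ sharing an endpoint, or one is an edge $e$ of $H$ and the other is a cut-vertex $c$ of $H$ incident with $e$. The first Zagreb coindex is $\overline{M_1}(G)=\sum [d_G(u)+d_G(v)]$, the sum taken over all unordered pairs $\{u,v\}$ of distinct vertices $u\neq v$ of $G$ with $uv\notin E(G)$. -}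

module Defs where

open import Data.Nat using (ℕ; zero; suc; _+_; _*_; _<_; _≤_)
open import Data.Nat.Properties using (_≟_) renaming (_<?_ to _<?ℕ_)
open import Data.Bool using (T?; Bool; true; false; T; not; _∧_; _∨_; if_then_else_)
open import Data.Fin using (Fin; toℕ)
open import Data.Fin.Properties using (_<?_) renaming (_≟_ to _≟ᶠ_)
open import Data.List using (List; map; allFin; filter; length)
open import Data.Nat.ListAction using (sum)
open import Data.Product using (Σ; ∃; _×_; _,_; proj₁; proj₂)
open import Data.Sum using (_⊎_; inj₁; inj₂)
open import Data.Empty using (⊥)
open import Relation.Nullary using (¬_; does; yes; no)
open import Data.Empty using (⊥-elim)
open import Data.Bool.Properties using (∨-comm)
import Relation.Binary.PropositionalEquality as P
open import Relation.Binary.PropositionalEquality using (_≡_; _≢_; refl)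
open import Function.Bundles using (_⇔_)

record Graph (m : ℕ) : Set where
  field
    adj   : Fin m → Fin m → Bool
    sym   : ∀ u v → adj u v ≡ adj v u
    irrefl : ∀ v → adj v v ≡ false
open Graph public

Adj : ∀ {m} → Graph m → Fin m → Fin m → Set
Adj G u v = T (adj G u v)

deg : ∀ {m} → Graph m → Fin m → ℕ
deg {m} G v = length (filter (λ w → T? (adj G v w)) (allFin m))

-- First Zagreb coindex: sum of d(u)+d(v) over unordered pairs {u,v},
-- u ≠ v, uv ∉ E(G).  Each unordered pair is counted once via toℕ u < toℕ v.
coindexM1 : ∀ {m} → Graph m → ℕ
coindexM1 {m} G =
  sum (map (λ u → sum (map (λ v → term u v) (allFin m))) (allFin m))
  where
    term : Fin m → Fin m → ℕ
    term u v = if does (u <? v) ∧ not (adj G u v) then deg G u + deg G v else 0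

IsEdge : ∀ {m} → Graph m → Fin m × Fin m → Set
IsEdge G (u , v) = (toℕ u < toℕ v) × Adj G u v

data Reach {m} (G : Graph m) : Fin m → Fin m → Set where
  here  : ∀ {u} → Reach G u u
  step  : ∀ {u v w} → Adj G u v → Reach G v w → Reach G u w

data ReachAvoid {m} (G : Graph m) (x : Fin m) : Fin m → Fin m → Set where
  here  : ∀ {u} → u ≢ x → ReachAvoid G x u u
  step  : ∀ {u v w} → u ≢ x → Adj G u v → ReachAvoid G x v w → ReachAvoid G x u w

-- x is a cut-vertex of G: deleting x increases the number of components,
-- i.e. there are two vertices u, w ≠ x in the same component of G
-- that lie in different components of G − x.
IsCutVertex : ∀ {m} → Graph m → Fin m → Set
IsCutVertex G x =
  ∃ λ u → ∃ λ w → u ≢ x × w ≢ x × Reach G u w × ¬ ReachAvoid G x u w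

-- Cycle-star graph CS_{k,l} on Fin (k + l): vertices 0..k-1 form the cycle
-- 0-1-...-(k-1)-0 (i ~ i+1 mod k), and vertices k..k+l-1 are leaves
-- attached to vertex 0.  (Used with k ≥ 3.)
-- csArc k i j : "i → j" is a cycle step or a spoke from 0 to a leaf;
-- the adjacency is its symmetrisation with loops removed.
csArc : ℕ → ℕ → ℕ → Bool
csArc k i j =
  (does (i <?ℕ k) ∧ does (j <?ℕ k) ∧ (does (suc i ≟ j) ∨ (does (j ≟ 0) ∧ does (suc i ≟ k))))
  ∨ (does (i ≟ 0) ∧ not (does (j <?ℕ k)))

csAdj : (k l : ℕ) → Fin (k + l) → Fin (k + l) → Bool
csAdj k l u v = not (does (u ≟ᶠ v)) ∧ (csArc k (toℕ u) (toℕ v) ∨ csArc k (toℕ v) (toℕ u))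

private
  ≟-sym : ∀ {n} (u v : Fin n) → does (u ≟ᶠ v) ≡ does (v ≟ᶠ u)
  ≟-sym u v with u ≟ᶠ v | v ≟ᶠ u
  ... | yes _ | yes _ = refl
  ... | no _  | no _  = refl
  ... | yes p | no q  = ⊥-elim (q (P.sym p))
  ... | no p  | yes q = ⊥-elim (p (P.sym q))

  ≟-refl : ∀ {n} (u : Fin n) → does (u ≟ᶠ u) ≡ true
  ≟-refl u with u ≟ᶠ u
  ... | yes _ = refl
  ... | no p  = ⊥-elim (p refl)

CS : (k l : ℕ) → Graph (k + l)
CS k l = record
  { adj = csAdj k l
  ; sym = λ u v → P.cong₂ (λ a b → not a ∧ b) (≟-sym u v)
                    (∨-comm (csArc k (toℕ u) (toℕ v)) (csArc k (toℕ v) (toℕ u)))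
  ; irrefl = λ v → P.cong (λ a → not a ∧ (csArc k (toℕ v) (toℕ v) ∨ csArc k (toℕ v) (toℕ v))) (≟-refl v)
  }

-- S is (a labelled copy of) the subdivision graph S(H): the map g identifies
-- V(S) bijectively with V(H) ⊎ E(H), where an edge of H is a pair (a , b)
-- with a < b adjacent in H, and a vertex a of H is adjacent in S exactly to
-- the edges of H incident with a (and nothing else is adjacent).
SubAdj : ∀ {m} → Fin m ⊎ (Fin m × Fin m) → Fin m ⊎ (Fin m × Fin m) → Set
SubAdj (inj₁ a) (inj₁ b) = ⊥
SubAdj (inj₁ a) (inj₂ (x , y)) = (a ≡ x) ⊎ (a ≡ y)
SubAdj (inj₂ (x , y)) (inj₁ a) = (a ≡ x) ⊎ (a ≡ y)
SubAdj (inj₂ _) (inj₂ _) = ⊥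

record IsSubdivision {m M} (H : Graph m) (S : Graph M) : Set where
  field
    g        : Fin M → Fin m ⊎ (Fin m × Fin m)
    g-inj    : ∀ x y → g x ≡ g y → x ≡ y
    g-vertex : ∀ a → ∃ λ x → g x ≡ inj₁ a
    g-edge   : ∀ e → (∃ λ x → g x ≡ inj₂ e) ⇔ IsEdge H e
    g-adj    : ∀ x y → Adj S x y ⇔ SubAdj (g x) (g y)

-- G is (a labelled copy of) the line cut-vertex graph L_c(H): the map f
-- identifies V(G) bijectively with E(H) ⊎ {cut-vertices of H}; two edges are
-- adjacent iff they are distinct and share an endpoint; an edge and a
-- cut-vertex are adjacent iff they are incident; two cut-vertices are never
-- adjacent.
ShareEnd : ∀ {m} → Fin m × Fin m → Fin m × Fin m → Set
ShareEnd (a , b) (c , d) = (a ≡ c) ⊎ (a ≡ d) ⊎ (b ≡ c) ⊎ (b ≡ d)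

Incident : ∀ {m} → Fin m → Fin m × Fin m → Set
Incident c (a , b) = (c ≡ a) ⊎ (c ≡ b)

LcAdj : ∀ {m} → (Fin m × Fin m) ⊎ Fin m → (Fin m × Fin m) ⊎ Fin m → Set
LcAdj (inj₁ e) (inj₁ e') = e ≢ e' × ShareEnd e e'
LcAdj (inj₁ e) (inj₂ c)  = Incident c e
LcAdj (inj₂ c) (inj₁ e)  = Incident c e
LcAdj (inj₂ _) (inj₂ _)  = ⊥

record IsLineCutVertexGraph {m N} (H : Graph m) (G : Graph N) : Set where
  field
    f       : Fin N → (Fin m × Fin m) ⊎ Fin m
    f-inj   : ∀ x y → f x ≡ f y → x ≡ y
    f-edge  : ∀ e → (∃ λ x → f x ≡ inj₁ e) ⇔ IsEdge H e
    f-cut   : ∀ c → (∃ λ x → f x ≡ inj₂ c) ⇔ IsCutVertex H c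
    f-adj   : ∀ x y → Adj G x y ⇔ LcAdj (f x) (f y)

{-# OPTIONS --safe #-}
-- Every vertex u of a graph on m vertices lies in m − 1 − d(u) non-adjacent pairs, so the first Zagreb coindex
-- equals Σ_u d(u)(m − 1 − d(u)) and depends only on the degrees.  In S = S(CS_{k,l}) the cut vertices are the hub
-- and the l subdivision vertices of the pendant edges, so L_c(S) is isomorphic to an explicit graph on
-- 2k + 3l + 1 vertices: the two edges joining the hub to the cycle have degree l + 3, the l edges joining the hub
-- to the pendant paths have degree l + 4, the hub has degree l + 2, and the remaining 2k + 2l − 2 vertices have
-- degree 2.  Summing d(m − 1 − d) over this degree sequence gives the polynomial.
module Submission where

open import Defs hiding (sym)
open import Data.Bool using (Bool; true; false; not; _∧_; _∨_; T; T?; if_then_else_)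
open import Data.Bool.Properties using (T-∧; T-∨; T-≡; ⇔→≡; ∧-zeroʳ; ∧-idem; ∧-identityʳ)
open import Data.Empty using (⊥; ⊥-elim)
open import Data.Fin using (Fin; zero; suc; toℕ; fromℕ<)
open import Data.Fin.Properties using (toℕ-injective; toℕ<n; toℕ-fromℕ<) renaming (_≟_ to _≟ᶠ_)
import Data.Fin.Properties as Fin
open import Data.List using (List; []; _∷_; _++_; map; allFin; filter; length; applyUpTo)
open import Data.List.Properties using (map-tabulate; length-tabulate; map-++; map-cong; map-applyUpTo)
open import Data.List.Membership.Propositional using (_∈_)
open import Data.List.Membership.Propositional.Properties
  using (∈-++⁻; ∈-++⁺ˡ; ∈-++⁺ʳ; ∈-applyUpTo⁻; ∈-applyUpTo⁺)
open import Data.List.Relation.Unary.Any using (here; there)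
open import Data.Nat using (ℕ; zero; suc; _≤_; _<_; _∸_; _≡ᵇ_; _<ᵇ_; z≤n; s≤s; z<s; s<s)
import Data.Nat as ℕ
open import Data.Nat.ListAction using (sum)
open import Data.Nat.ListAction.Properties using (sum-++)
open import Data.Product using (∃; _×_; _,_; proj₁; proj₂)
open import Data.Sum using (_⊎_; inj₁; inj₂; swap) renaming (map to map-⊎)
open import Data.Sum.Function.Propositional using (_⊎-⇔_)
open import Data.Unit using (tt)
open import Function using (_∘_; _⇔_; Equivalence; mk⇔; const; case_of_)
open Equivalence using (to; from)
open import Function.Properties.Equivalence using () renaming (trans to ⇔-trans; sym to ⇔-sym)
open import Relation.Binary using (DecidableEquality; tri<; tri≈; tri>)
open import Relation.Binary.PropositionalEquality
  using (_≡_; _≢_; _≗_; refl; sym; trans; cong; cong₂; subst; subst₂; module ≡-Reasoning)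
open import Relation.Nullary using (¬_; Dec; yes; no; does)
open import Relation.Nullary.Decidable using (map′; dec-true; dec-false; _×-dec_)

T-does : ∀ {A : Set} (a? : Dec A) → T (does a?) ⇔ A
T-does (yes a) = mk⇔ (const a) (const tt)
T-does (no ¬a) = mk⇔ (λ ()) ¬a

T-⇔⇒≡ : ∀ {a b} → T a ⇔ T b → a ≡ b
T-⇔⇒≡ h = ⇔→≡ (⇔-trans (⇔-sym T-≡) (⇔-trans h T-≡))

module _ {m} {G : Graph m} where

  ReachAvoid-start : ∀ {x u w} → ReachAvoid G x u w → u ≢ x
  ReachAvoid-start (here u≢x)     = u≢x
  ReachAvoid-start (step u≢x _ _) = u≢x

  ReachAvoid-trans : ∀ {x u v w} → ReachAvoid G x u v → ReachAvoid G x v w → ReachAvoid G x u w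
  ReachAvoid-trans (here _)         r′ = r′
  ReachAvoid-trans (step u≢x uv r) r′ = step u≢x uv (ReachAvoid-trans r r′)

  ReachAvoid-sym : ∀ {x u w} → ReachAvoid G x u w → ReachAvoid G x w u
  ReachAvoid-sym (here u≢x)        = here u≢x
  ReachAvoid-sym {u = u} (step {v = v} u≢x uv r) =
    ReachAvoid-trans (ReachAvoid-sym r) (step (ReachAvoid-start r) (subst T (Graph.sym G u v) uv) (here u≢x))

  ReachAvoid-invariant : ∀ {x} (P : Fin m → Set) → (∀ {a b} → P a → Adj G a b → b ≢ x → P b) →
                         ∀ {u w} → ReachAvoid G x u w → P u → P w
  ReachAvoid-invariant P closed (here _)       pu = pu
  ReachAvoid-invariant P closed (step _ uv r) pu = ReachAvoid-invariant P closed r (closed pu uv (ReachAvoid-start r))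

  cut-by-invariant : ∀ {x u w} (P : Fin m → Set) → u ≢ x → w ≢ x → Adj G u x → Adj G x w →
                     (∀ {a b} → P a → Adj G a b → b ≢ x → P b) → P u → ¬ P w → IsCutVertex G x
  cut-by-invariant P u≢x w≢x ux xw closed pu ¬pw =
    _ , _ , u≢x , w≢x , step ux (step xw here) , λ r → ¬pw (ReachAvoid-invariant P closed r pu)

ShareEnd⇒common : ∀ {m} {e e′ : Fin m × Fin m} → ShareEnd e e′ → ∃ λ z → Incident z e × Incident z e′
ShareEnd⇒common (inj₁ refl)                 = _ , inj₁ refl , inj₁ refl
ShareEnd⇒common (inj₂ (inj₁ refl))          = _ , inj₁ refl , inj₂ refl
ShareEnd⇒common (inj₂ (inj₂ (inj₁ refl)))   = _ , inj₂ refl , inj₁ refl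
ShareEnd⇒common (inj₂ (inj₂ (inj₂ refl)))   = _ , inj₂ refl , inj₂ refl

common⇒ShareEnd : ∀ {m} {z} {e e′ : Fin m × Fin m} → Incident z e → Incident z e′ → ShareEnd e e′
common⇒ShareEnd (inj₁ refl) (inj₁ refl) = inj₁ refl
common⇒ShareEnd (inj₁ refl) (inj₂ refl) = inj₂ (inj₁ refl)
common⇒ShareEnd (inj₂ refl) (inj₁ refl) = inj₂ (inj₂ (inj₁ refl))
common⇒ShareEnd (inj₂ refl) (inj₂ refl) = inj₂ (inj₂ (inj₂ refl))

-- Natural-number arithmetic is opened only in here: the final statement uses the integer operators.
module Counting where

  open import Data.Nat using (_+_; _*_)
  open import Data.Nat.Properties
    using (_≟_; _<?_; <-cmp; suc-injective; +-comm; +-identityʳ; +-suc; +-cancelˡ-≡; +-cancelˡ-<; +-monoʳ-<;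
           *-comm; *-zeroʳ; *-identityʳ; *-suc; *-distribˡ-+; *-distribʳ-+; *-cancelˡ-≡; even≢odd;
           m+n∸m≡n; m+n∸n≡m; m+[n∸m]≡n; ≤-trans; ≤-antisym; ≤-pred; <-trans; <-irrefl; <-asym;
           <⇒≤; <⇒≢; >⇒≢; ≮⇒≥; <⇒<ᵇ; n<1+n; m<n⇒m<1+n; m≤m+n; +-commutativeSemigroup)
  open import Data.Nat.Tactic.RingSolver using (solve)
  open import Algebra.Properties.CommutativeSemigroup +-commutativeSemigroup using (interchange)

  ind : Bool → ℕ
  ind true  = 1
  ind false = 0

  ∑ : {A : Set} → List A → (A → ℕ) → ℕ
  ∑ xs f = sum (map f xs)

  infix 5 ∑
  syntax ∑ xs (λ x → e) = ∑[ x ← xs ] e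

  module _ {A : Set} where

    ∑-cong : ∀ (xs : List A) {f g : A → ℕ} → (∀ {x} → x ∈ xs → f x ≡ g x) → ∑ xs f ≡ ∑ xs g
    ∑-cong []       _  = refl
    ∑-cong (x ∷ xs) eq = cong₂ _+_ (eq (here refl)) (∑-cong xs (eq ∘ there))

    ∑-cong-≗ : ∀ (xs : List A) {f g : A → ℕ} → f ≗ g → ∑ xs f ≡ ∑ xs g
    ∑-cong-≗ xs eq = cong sum (map-cong eq xs)

    ∑-distrib-+ : ∀ (xs : List A) (f g : A → ℕ) → ∑[ x ← xs ] (f x + g x) ≡ ∑ xs f + ∑ xs g
    ∑-distrib-+ []       f g = refl
    ∑-distrib-+ (x ∷ xs) f g =
      trans (cong (f x + g x +_) (∑-distrib-+ xs f g)) (interchange (f x) (g x) (∑ xs f) (∑ xs g))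

    ∑-*ʳ : ∀ (xs : List A) (f : A → ℕ) c → ∑[ x ← xs ] (f x * c) ≡ ∑ xs f * c
    ∑-*ʳ []       f c = refl
    ∑-*ʳ (x ∷ xs) f c = trans (cong (f x * c +_) (∑-*ʳ xs f c)) (sym (*-distribʳ-+ c (f x) (∑ xs f)))

    ∑-++ : ∀ (xs ys : List A) (f : A → ℕ) → ∑ (xs ++ ys) f ≡ ∑ xs f + ∑ ys f
    ∑-++ xs ys f = trans (cong sum (map-++ f xs ys)) (sum-++ (map f xs) (map f ys))

    ∑-zero : ∀ (xs : List A) → ∑[ _ ← xs ] 0 ≡ 0
    ∑-zero []       = refl
    ∑-zero (_ ∷ xs) = ∑-zero xs

    ∑-one : ∀ (xs : List A) → ∑[ _ ← xs ] 1 ≡ length xs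
    ∑-one []       = refl
    ∑-one (_ ∷ xs) = cong suc (∑-one xs)

    length-filter≡∑ : ∀ (p : A → Bool) xs → length (filter (T? ∘ p) xs) ≡ ∑[ x ← xs ] ind (p x)
    length-filter≡∑ p []       = refl
    length-filter≡∑ p (x ∷ xs) with p x
    ... | true  = cong suc (length-filter≡∑ p xs)
    ... | false = length-filter≡∑ p xs

  ∑-comm : ∀ {A B : Set} (xs : List A) (ys : List B) (F : A → B → ℕ) →
           ∑[ x ← xs ] ∑[ y ← ys ] F x y ≡ ∑[ y ← ys ] ∑[ x ← xs ] F x y
  ∑-comm []       ys F = sym (∑-zero ys)
  ∑-comm (x ∷ xs) ys F = trans (cong (∑ ys (F x) +_) (∑-comm xs ys F))
                               (sym (∑-distrib-+ ys (F x) (λ y → ∑[ x ← xs ] F x y)))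

  ∑-allFin-suc : ∀ m (h : Fin (suc m) → ℕ) → ∑ (allFin (suc m)) h ≡ h zero + (∑[ i ← allFin m ] h (suc i))
  ∑-allFin-suc m h = cong (λ xs → h zero + sum xs)
    (trans (map-tabulate suc h) (sym (map-tabulate (λ i → i) (h ∘ suc))))

  length-allFin : ∀ m → length (allFin m) ≡ m
  length-allFin m = length-tabulate (λ i → i)

  ∑-allFin-≟ : ∀ {m} (u : Fin m) → ∑[ v ← allFin m ] ind (does (v ≟ᶠ u)) ≡ 1
  ∑-allFin-≟ {suc m} zero    = trans (∑-allFin-suc m (λ v → ind (does (v ≟ᶠ zero)))) (cong suc (∑-zero (allFin m)))
  ∑-allFin-≟ {suc m} (suc u) = trans (∑-allFin-suc m (λ v → ind (does (v ≟ᶠ suc u)))) (∑-allFin-≟ u)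

  if-then-0 : ∀ b x → (if b then x else 0) ≡ ind b * x
  if-then-0 true  x = sym (+-identityʳ x)
  if-then-0 false x = refl

  module _ {m} (G : Graph m) where

    private
      V = allFin m

    deg≡∑adj : ∀ u → deg G u ≡ ∑[ v ← V ] ind (adj G u v)
    deg≡∑adj u = length-filter≡∑ (adj G u) V

    nonAdj< : Fin m → Fin m → Bool
    nonAdj< u v = does (u Fin.<? v) ∧ not (adj G u v)

    nonDeg : Fin m → ℕ
    nonDeg u = ∑[ v ← V ] (ind (nonAdj< u v) + ind (nonAdj< v u))

    nonAdj<-partition : ∀ u v → ind (nonAdj< u v) + ind (nonAdj< v u) + ind (does (v ≟ᶠ u)) + ind (adj G u v) ≡ 1
    nonAdj<-partition u v rewrite Graph.sym G v u with Fin.<-cmp u v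
    ... | tri< u<v u≢v _
      rewrite dec-true (u Fin.<? v) u<v | dec-false (v Fin.<? u) (Fin.<-asym u<v) | dec-false (v ≟ᶠ u) (u≢v ∘ sym)
      with adj G u v
    ...   | true  = refl
    ...   | false = refl
    nonAdj<-partition u v | tri> _ u≢v v<u
      rewrite dec-false (u Fin.<? v) (Fin.<-asym v<u) | dec-true (v Fin.<? u) v<u | dec-false (v ≟ᶠ u) (u≢v ∘ sym)
      with adj G u v
    ...   | true  = refl
    ...   | false = refl
    nonAdj<-partition u .u | tri≈ u≮u refl _
      rewrite dec-false (u Fin.<? u) u≮u | dec-true (u ≟ᶠ u) refl | Graph.irrefl G u = refl

    suc-nonDeg+deg : ∀ u → suc (nonDeg u + deg G u) ≡ m
    suc-nonDeg+deg u = begin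
      suc (nonDeg u + deg G u)
        ≡⟨ cong (_+ deg G u) (+-comm 1 (nonDeg u)) ⟩
      nonDeg u + 1 + deg G u
        ≡⟨ cong₂ (λ o d → nonDeg u + o + d) (sym (∑-allFin-≟ u)) (deg≡∑adj u) ⟩
      nonDeg u + (∑[ v ← V ] ind (does (v ≟ᶠ u))) + (∑[ v ← V ] ind (adj G u v))
        ≡⟨ cong (_+ (∑[ v ← V ] ind (adj G u v))) (sym (∑-distrib-+ V _ _)) ⟩
      (∑[ v ← V ] (ind (nonAdj< u v) + ind (nonAdj< v u) + ind (does (v ≟ᶠ u)))) + (∑[ v ← V ] ind (adj G u v))
        ≡⟨ sym (∑-distrib-+ V _ _) ⟩
      ∑[ v ← V ] (ind (nonAdj< u v) + ind (nonAdj< v u) + ind (does (v ≟ᶠ u)) + ind (adj G u v))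
        ≡⟨ ∑-cong-≗ V (nonAdj<-partition u) ⟩
      ∑[ v ← V ] 1
        ≡⟨ trans (∑-one V) (length-allFin m) ⟩
      m ∎
      where open ≡-Reasoning

    -- Each non-adjacent pair u < v contributes deg u + deg v; regroup by the vertex whose degree is counted.
    coindexM1≡∑nonDeg*deg : coindexM1 G ≡ ∑[ u ← V ] nonDeg u * deg G u
    coindexM1≡∑nonDeg*deg = begin
      coindexM1 G
        ≡⟨ ∑-cong-≗ V (λ u → ∑-cong-≗ V (λ v → if-then-0 (nonAdj< u v) (deg G u + deg G v))) ⟩
      ∑[ u ← V ] ∑[ v ← V ] ind (nonAdj< u v) * (deg G u + deg G v)
        ≡⟨ ∑-cong-≗ V (λ u → trans (∑-cong-≗ V (λ v → *-distribˡ-+ (ind (nonAdj< u v)) (deg G u) (deg G v)))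
                                    (∑-distrib-+ V _ _)) ⟩
      ∑[ u ← V ] ((∑[ v ← V ] ind (nonAdj< u v) * deg G u) + (∑[ v ← V ] ind (nonAdj< u v) * deg G v))
        ≡⟨ ∑-distrib-+ V _ _ ⟩
      (∑[ u ← V ] ∑[ v ← V ] ind (nonAdj< u v) * deg G u) + (∑[ u ← V ] ∑[ v ← V ] ind (nonAdj< u v) * deg G v)
        ≡⟨ cong ((∑[ u ← V ] ∑[ v ← V ] ind (nonAdj< u v) * deg G u) +_)
                (∑-comm V V (λ u v → ind (nonAdj< u v) * deg G v)) ⟩
      (∑[ u ← V ] ∑[ v ← V ] ind (nonAdj< u v) * deg G u) + (∑[ u ← V ] ∑[ v ← V ] ind (nonAdj< v u) * deg G u)
        ≡⟨ sym (∑-distrib-+ V _ _) ⟩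
      ∑[ u ← V ] ((∑[ v ← V ] ind (nonAdj< u v) * deg G u) + (∑[ v ← V ] ind (nonAdj< v u) * deg G u))
        ≡⟨ ∑-cong-≗ V (λ u → trans (sym (∑-distrib-+ V _ _))
             (trans (∑-cong-≗ V (λ v → sym (*-distribʳ-+ (deg G u) (ind (nonAdj< u v)) (ind (nonAdj< v u)))))
                    (∑-*ʳ V _ (deg G u)))) ⟩
      ∑[ u ← V ] nonDeg u * deg G u ∎
      where open ≡-Reasoning

    coindexM1-by-degrees : coindexM1 G ≡ ∑[ u ← V ] deg G u * (m ∸ suc (deg G u))
    coindexM1-by-degrees = trans coindexM1≡∑nonDeg*deg (∑-cong-≗ V λ u →
      trans (*-comm (nonDeg u) (deg G u)) (cong (deg G u *_) (sym (begin
        m ∸ suc (deg G u)                      ≡⟨ cong (_∸ suc (deg G u)) (sym (suc-nonDeg+deg u)) ⟩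
        suc (nonDeg u + deg G u) ∸ suc (deg G u) ≡⟨ m+n∸n≡m (nonDeg u) (deg G u) ⟩
        nonDeg u ∎))))
      where open ≡-Reasoning

  module Reindex {m} {C : Set} (_≟ᶜ_ : DecidableEquality C) (enum : List C) (π : Fin m → C)
    (π-injective : ∀ {u v} → π u ≡ π v → u ≡ v)
    (π∈enum : ∀ u → π u ∈ enum)
    (π-onto : ∀ {c} → c ∈ enum → ∃ λ u → π u ≡ c)
    (enum-once : ∀ {c} → c ∈ enum → ∑[ c′ ← enum ] ind (does (c ≟ᶜ c′)) ≡ 1) where

    private
      V = allFin m

    ≟-π : ∀ u v → does (π u ≟ᶜ π v) ≡ does (u ≟ᶠ v)
    ≟-π u v with u ≟ᶠ v
    ... | yes refl = dec-true (π u ≟ᶜ π u) refl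
    ... | no u≢v   = dec-false (π u ≟ᶜ π v) (u≢v ∘ π-injective)

    fibre-size : ∀ {c} → c ∈ enum → ∑[ u ← V ] ind (does (π u ≟ᶜ c)) ≡ 1
    fibre-size c∈ with π-onto c∈
    ... | u₀ , refl = trans (∑-cong-≗ V (λ u → cong ind (≟-π u u₀))) (∑-allFin-≟ u₀)

    -- Both sides count the pairs (u, c) with π u = c, weighted by h c.
    ∑-reindex : ∀ (h : C → ℕ) → ∑[ u ← V ] h (π u) ≡ ∑[ c ← enum ] h c
    ∑-reindex h = begin
      ∑[ u ← V ] h (π u)
        ≡⟨ ∑-cong-≗ V (λ u → sym (trans (cong (_* h (π u)) (enum-once (π∈enum u))) (+-identityʳ _))) ⟩
      ∑[ u ← V ] (∑[ c ← enum ] ind (does (π u ≟ᶜ c))) * h (π u)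
        ≡⟨ ∑-cong-≗ V (λ u → sym (∑-*ʳ enum (λ c → ind (does (π u ≟ᶜ c))) (h (π u)))) ⟩
      ∑[ u ← V ] ∑[ c ← enum ] ind (does (π u ≟ᶜ c)) * h (π u)
        ≡⟨ ∑-cong-≗ V (λ u → ∑-cong-≗ enum (λ c → only-at (π u) c)) ⟩
      ∑[ u ← V ] ∑[ c ← enum ] ind (does (π u ≟ᶜ c)) * h c
        ≡⟨ ∑-comm V enum (λ u c → ind (does (π u ≟ᶜ c)) * h c) ⟩
      ∑[ c ← enum ] ∑[ u ← V ] ind (does (π u ≟ᶜ c)) * h c
        ≡⟨ ∑-cong-≗ enum (λ c → ∑-*ʳ V (λ u → ind (does (π u ≟ᶜ c))) (h c)) ⟩
      ∑[ c ← enum ] (∑[ u ← V ] ind (does (π u ≟ᶜ c))) * h c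
        ≡⟨ ∑-cong enum (λ {c} c∈ → trans (cong (_* h c) (fibre-size c∈)) (+-identityʳ (h c))) ⟩
      ∑[ c ← enum ] h c ∎
      where
      open ≡-Reasoning
      only-at : ∀ c c′ → ind (does (c ≟ᶜ c′)) * h c ≡ ind (does (c ≟ᶜ c′)) * h c′
      only-at c c′ with c ≟ᶜ c′
      ... | yes refl = refl
      ... | no _     = refl

    module _ (G : Graph m) (adjᶜ : C → C → Bool) (adj-π : ∀ u v → adj G u v ≡ adjᶜ (π u) (π v)) where

      degᶜ : C → ℕ
      degᶜ c = ∑[ c′ ← enum ] ind (adjᶜ c c′)

      deg-π : ∀ u → deg G u ≡ degᶜ (π u)
      deg-π u = trans (deg≡∑adj G u)
                      (trans (∑-cong-≗ V (cong ind ∘ adj-π u)) (∑-reindex (ind ∘ adjᶜ (π u))))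

      size-π : m ≡ length enum
      size-π = trans (sym (length-allFin m))
                     (trans (sym (∑-one V)) (trans (∑-reindex (λ _ → 1)) (∑-one enum)))

      coindexM1-coded : coindexM1 G ≡ ∑[ c ← enum ] degᶜ c * (length enum ∸ suc (degᶜ c))
      coindexM1-coded = trans (coindexM1-by-degrees G)
        (trans (∑-cong-≗ V (λ u → cong₂ (λ d s → d * (s ∸ suc d)) (deg-π u) size-π))
               (∑-reindex (λ c → degᶜ c * (length enum ∸ suc (degᶜ c)))))

  ∑< : ℕ → (ℕ → ℕ) → ℕ
  ∑< m f = sum (applyUpTo f m)

  ∑-applyUpTo : ∀ {A : Set} m (g : ℕ → A) f → ∑ (applyUpTo g m) f ≡ ∑< m (f ∘ g)
  ∑-applyUpTo m g f = cong sum (map-applyUpTo g f m)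

  ∑<-cong : ∀ m {f g : ℕ → ℕ} → (∀ {i} → i < m → f i ≡ g i) → ∑< m f ≡ ∑< m g
  ∑<-cong zero    eq = refl
  ∑<-cong (suc m) eq = cong₂ _+_ (eq z<s) (∑<-cong m (eq ∘ s<s))

  ∑<-const : ∀ m {f : ℕ → ℕ} c → (∀ {i} → i < m → f i ≡ c) → ∑< m f ≡ m * c
  ∑<-const zero    c eq = refl
  ∑<-const (suc m) c eq = cong₂ _+_ (eq z<s) (∑<-const m c (eq ∘ s<s))

  ∑<-zero : ∀ m {f : ℕ → ℕ} → (∀ {i} → i < m → f i ≡ 0) → ∑< m f ≡ 0
  ∑<-zero m eq = trans (∑<-const m 0 eq) (*-zeroʳ m)

  ∑<-one : ∀ m {f : ℕ → ℕ} → (∀ {i} → i < m → f i ≡ 1) → ∑< m f ≡ m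
  ∑<-one m eq = trans (∑<-const m 1 eq) (*-identityʳ m)

  ∑<-distrib-+ : ∀ m (f g : ℕ → ℕ) → ∑< m (λ i → f i + g i) ≡ ∑< m f + ∑< m g
  ∑<-distrib-+ zero    f g = refl
  ∑<-distrib-+ (suc m) f g =
    trans (cong (f 0 + g 0 +_) (∑<-distrib-+ m (f ∘ suc) (g ∘ suc)))
          (interchange (f 0) (g 0) (∑< m (f ∘ suc)) (∑< m (g ∘ suc)))

  ∑<-≡ᵇ : ∀ m x → ∑< m (λ i → ind (x ≡ᵇ i)) ≡ ind (x <ᵇ m)
  ∑<-≡ᵇ zero    x       = refl
  ∑<-≡ᵇ (suc m) zero    = cong suc (∑<-zero m (λ _ → refl))
  ∑<-≡ᵇ (suc m) (suc x) = ∑<-≡ᵇ m x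

  ∑<-≡ᵇ-< : ∀ m {x} → x < m → ∑< m (λ i → ind (x ≡ᵇ i)) ≡ 1
  ∑<-≡ᵇ-< m {x} x<m = trans (∑<-≡ᵇ m x) (cong ind (dec-true? x<m))
    where
    dec-true? : x < m → (x <ᵇ m) ≡ true
    dec-true? p with x <ᵇ m | <⇒<ᵇ p
    ... | true | _ = refl

  ∑<-≢ᵇ : ∀ m {x} → x < m → suc (∑< m (λ i → ind (not (x ≡ᵇ i)))) ≡ m
  ∑<-≢ᵇ (suc m) {zero}  _         = cong suc (∑<-one m (λ _ → refl))
  ∑<-≢ᵇ (suc m) {suc x} (s<s x<m) = cong suc (∑<-≢ᵇ m x<m)

  -- Vertices of S(CS_{k,l}): orig v is the vertex v of CS_{k,l} (0 the hub, 0 … k−1 the cycle, k … k+l−1 the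
  -- leaves), cyc i subdivides the cycle edge {i, i+1 mod k}, pend j subdivides the pendant edge {0, k+j}.
  data SVertex : Set where
    orig : ℕ → SVertex
    cyc  : ℕ → SVertex
    pend : ℕ → SVertex

  -- Vertices of L_c(S): an edge of S, written with its orig end first, or a cut vertex of S.
  data LVertex : Set where
    edge : SVertex → SVertex → LVertex
    cut  : SVertex → LVertex

  isOrig : SVertex → Bool
  isOrig (orig _) = true
  isOrig _        = false

  orig-injective : ∀ {a b} → orig a ≡ orig b → a ≡ b
  orig-injective refl = refl

  cyc-injective : ∀ {a b} → cyc a ≡ cyc b → a ≡ b
  cyc-injective refl = refl

  pend-injective : ∀ {a b} → pend a ≡ pend b → a ≡ b
  pend-injective refl = refl

  _≟ˢ_ : DecidableEquality SVertex
  orig a ≟ˢ orig b = map′ (cong orig) orig-injective (a ≟ b)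
  cyc a  ≟ˢ cyc b  = map′ (cong cyc)  cyc-injective  (a ≟ b)
  pend a ≟ˢ pend b = map′ (cong pend) pend-injective (a ≟ b)
  orig _ ≟ˢ cyc _  = no λ ()
  orig _ ≟ˢ pend _ = no λ ()
  cyc _  ≟ˢ orig _ = no λ ()
  cyc _  ≟ˢ pend _ = no λ ()
  pend _ ≟ˢ orig _ = no λ ()
  pend _ ≟ˢ cyc _  = no λ ()

  _≟ᴸ_ : DecidableEquality LVertex
  edge v s ≟ᴸ edge v′ s′ =
    map′ (λ { (refl , refl) → refl }) (λ { refl → refl , refl }) (v ≟ˢ v′ ×-dec s ≟ˢ s′)
  cut z    ≟ᴸ cut z′     = map′ (cong cut) (λ { refl → refl }) (z ≟ˢ z′)
  edge _ _ ≟ᴸ cut _      = no λ ()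
  cut _    ≟ᴸ edge _ _   = no λ ()

  -- Since an edge of S joins an orig vertex to a subdivision vertex, two edges share an end iff they agree in
  -- one component.
  meets : LVertex → LVertex → Bool
  meets (edge v s) (edge v′ s′) = does (v ≟ˢ v′) ∨ does (s ≟ˢ s′)
  meets (edge v s) (cut z)      = does (v ≟ˢ z) ∨ does (s ≟ˢ z)
  meets (cut z)    (edge v s)   = does (z ≟ˢ v) ∨ does (z ≟ˢ s)
  meets (cut _)    (cut _)      = false

  modelAdj : LVertex → LVertex → Bool
  modelAdj c c′ = not (does (c ≟ᴸ c′)) ∧ meets c c′

  module Model (k′ l : ℕ) where

    K k : ℕ
    K = 2 + k′
    k = suc K

    hubCyc₀ hubCycK hubCut : LVertex
    hubCyc₀ = edge (orig 0) (cyc 0)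
    hubCycK = edge (orig 0) (cyc K)
    hubCut  = cut (orig 0)

    -- cycFwd i and cycBwd i join the cycle vertex i + 1 to the subdivision vertices after and before it.
    cycFwd cycBwd hubPend leafPend pendCut : ℕ → LVertex
    cycFwd i   = edge (orig (suc i)) (cyc (suc i))
    cycBwd i   = edge (orig (suc i)) (cyc i)
    hubPend j  = edge (orig 0) (pend j)
    leafPend j = edge (orig (k + j)) (pend j)
    pendCut j  = cut (pend j)

    enum : List LVertex
    enum = hubCyc₀ ∷ applyUpTo cycFwd K ++ applyUpTo cycBwd K ++ hubCycK
         ∷ applyUpTo hubPend l ++ applyUpTo leafPend l ++ hubCut ∷ applyUpTo pendCut l

    ∑-enum : ∀ (f : LVertex → ℕ) {a b c d e g h i} →
      f hubCyc₀ ≡ a → ∑< K (f ∘ cycFwd) ≡ b → ∑< K (f ∘ cycBwd) ≡ c → f hubCycK ≡ d →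
      ∑< l (f ∘ hubPend) ≡ e → ∑< l (f ∘ leafPend) ≡ g → f hubCut ≡ h → ∑< l (f ∘ pendCut) ≡ i →
      ∑ enum f ≡ a + (b + (c + (d + (e + (g + (h + i))))))
    ∑-enum f refl refl refl refl refl refl refl refl =
      cong (f hubCyc₀ +_) (split (applyUpTo cycFwd K) (∑-applyUpTo K cycFwd f)
        (split (applyUpTo cycBwd K) (∑-applyUpTo K cycBwd f)
          (cong (f hubCycK +_) (split (applyUpTo hubPend l) (∑-applyUpTo l hubPend f)
            (split (applyUpTo leafPend l) (∑-applyUpTo l leafPend f)
              (cong (f hubCut +_) (∑-applyUpTo l pendCut f)))))))
      where
      split : ∀ xs {ys x y} → ∑ xs f ≡ x → ∑ ys f ≡ y → ∑ (xs ++ ys) f ≡ x + y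
      split xs {ys} refl refl = ∑-++ xs ys f

    degᴹ : LVertex → ℕ
    degᴹ c = ∑[ c′ ← enum ] ind (modelAdj c c′)

    multiplicity : LVertex → ℕ
    multiplicity c = ∑[ c′ ← enum ] ind (does (c ≟ᴸ c′))

    -- For two edges of S, modelAdj is the exclusive or of agreement in their two components.
    private
      xor-disjoint : ∀ X Y → X ∧ Y ≡ false → ind (not (X ∧ Y) ∧ (X ∨ Y)) ≡ ind X + ind Y
      xor-disjoint true  true  ()
      xor-disjoint true  false _ = refl
      xor-disjoint false true  _ = refl
      xor-disjoint false false _ = refl

      xor-self : ∀ X → ind (not (X ∧ X) ∧ (X ∨ X)) ≡ 0
      xor-self true  = refl
      xor-self false = refl

      ≡ᵇ-suc-disjointˡ : ∀ x y → (x ≡ᵇ y) ∧ (suc x ≡ᵇ y) ≡ false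
      ≡ᵇ-suc-disjointˡ zero    zero    = refl
      ≡ᵇ-suc-disjointˡ zero    (suc y) = refl
      ≡ᵇ-suc-disjointˡ (suc x) zero    = refl
      ≡ᵇ-suc-disjointˡ (suc x) (suc y) = ≡ᵇ-suc-disjointˡ x y

      ≡ᵇ-suc-disjointʳ : ∀ x y → (x ≡ᵇ y) ∧ (x ≡ᵇ suc y) ≡ false
      ≡ᵇ-suc-disjointʳ zero    zero    = refl
      ≡ᵇ-suc-disjointʳ zero    (suc y) = refl
      ≡ᵇ-suc-disjointʳ (suc x) zero    = refl
      ≡ᵇ-suc-disjointʳ (suc x) (suc y) = ≡ᵇ-suc-disjointʳ x y

      <ᵇ+≡ᵇ : ∀ x m → x ≤ m → ind (x <ᵇ m) + ind (x ≡ᵇ m) ≡ 1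
      <ᵇ+≡ᵇ zero    zero    _         = refl
      <ᵇ+≡ᵇ zero    (suc m) _         = refl
      <ᵇ+≡ᵇ (suc x) (suc m) (s≤s x≤m) = <ᵇ+≡ᵇ x m x≤m

      cycle≢leaf : ∀ {i} j → i < k → (i ≡ᵇ k + j) ≡ false
      cycle≢leaf {i} j i<k = dec-false (i ≟ k + j) (λ i≡ → <-irrefl i≡ (≤-trans i<k (m≤m+n k j)))

      leaf≢cycle : ∀ {i} j → i < k → (k + j ≡ᵇ i) ≡ false
      leaf≢cycle {i} j i<k = dec-false (k + j ≟ i) (λ i≡ → <-irrefl (sym i≡) (≤-trans i<k (m≤m+n k j)))

      ≡ᵇ-+ : ∀ a x y → (a + x ≡ᵇ a + y) ≡ (x ≡ᵇ y)
      ≡ᵇ-+ zero    x y = refl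
      ≡ᵇ-+ (suc a) x y = ≡ᵇ-+ a x y

    deg-hubCyc₀ : degᴹ hubCyc₀ ≡ 3 + l
    deg-hubCyc₀ = trans
      (∑-enum (ind ∘ modelAdj hubCyc₀) refl (∑<-zero K (λ _ → refl)) (∑<-≡ᵇ-< K z<s) refl
        (∑<-one l (λ _ → refl)) (∑<-zero l (λ _ → refl)) refl (∑<-zero l (λ _ → refl)))
      (cong (2 +_) (+-comm l 1))

    deg-cycFwd : ∀ {i} → i < K → degᴹ (cycFwd i) ≡ 2
    deg-cycFwd {i} i<K = trans
      (∑-enum (ind ∘ modelAdj (cycFwd i)) refl (∑<-zero K (λ {i′} _ → xor-self (i ≡ᵇ i′)))
        (trans (∑<-cong K (λ {i′} _ → xor-disjoint (i ≡ᵇ i′) (suc i ≡ᵇ i′) (≡ᵇ-suc-disjointˡ i i′)))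
               (trans (∑<-distrib-+ K (λ i′ → ind (i ≡ᵇ i′)) (λ i′ → ind (suc i ≡ᵇ i′)))
                      (cong₂ _+_ (∑<-≡ᵇ-< K i<K) (∑<-≡ᵇ K (suc i)))))
        refl (∑<-zero l (λ _ → refl))
        (∑<-zero l (λ {j} _ → cong (λ X → ind (not (X ∧ false) ∧ (X ∨ false))) (cycle≢leaf j (s≤s i<K))))
        refl (∑<-zero l (λ _ → refl)))
      (cong suc (trans (cong (ind (suc i <ᵇ K) +_) (+-identityʳ _)) (<ᵇ+≡ᵇ (suc i) K i<K)))

    deg-cycBwd : ∀ {i} → i < K → degᴹ (cycBwd i) ≡ 2
    deg-cycBwd {i} i<K = trans
      (∑-enum (ind ∘ modelAdj (cycBwd i)) refl
        (trans (∑<-cong K (λ {i′} _ → xor-disjoint (i ≡ᵇ i′) (i ≡ᵇ suc i′) (≡ᵇ-suc-disjointʳ i i′)))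
               (trans (∑<-distrib-+ K (λ i′ → ind (i ≡ᵇ i′)) (λ i′ → ind (i ≡ᵇ suc i′)))
                      (cong (_+ ∑< K (λ i′ → ind (i ≡ᵇ suc i′))) (∑<-≡ᵇ-< K i<K))))
        (∑<-zero K (λ {i′} _ → xor-self (i ≡ᵇ i′)))
        (cong ind (dec-false (i ≟ K) (<⇒≢ i<K))) (∑<-zero l (λ _ → refl))
        (∑<-zero l (λ {j} _ → cong (λ X → ind (not (X ∧ false) ∧ (X ∨ false))) (cycle≢leaf j (s≤s i<K))))
        refl (∑<-zero l (λ _ → refl)))
      (trans (cong (ind (i ≡ᵇ 0) +_) (+-identityʳ _))
             (trans (+-suc (ind (i ≡ᵇ 0)) _) (cong suc (∑<-≡ᵇ-< (suc K) (s≤s (<⇒≤ i<K))))))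

    deg-hubCycK : degᴹ hubCycK ≡ 3 + l
    deg-hubCycK = trans
      (∑-enum (ind ∘ modelAdj hubCycK) refl (∑<-≡ᵇ-< K (n<1+n (suc k′)))
        (∑<-zero K (λ i<K → cong ind (dec-false (K ≟ _) (>⇒≢ i<K))))
        (cong (λ X → ind (not X ∧ true)) (dec-true (k′ ≟ k′) refl))
        (∑<-one l (λ _ → refl)) (∑<-zero l (λ _ → refl)) refl (∑<-zero l (λ _ → refl)))
      (cong (2 +_) (+-comm l 1))

    deg-hubPend : ∀ {j} → j < l → degᴹ (hubPend j) ≡ 4 + l
    deg-hubPend {j} j<l = trans
      (∑-enum (ind ∘ modelAdj (hubPend j)) refl (∑<-zero K (λ _ → refl)) (∑<-zero K (λ _ → refl)) refl
        (∑<-cong l (λ {j′} _ → cong ind (∧-identityʳ (not (j ≡ᵇ j′)))))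
        (∑<-≡ᵇ-< l j<l) refl (∑<-≡ᵇ-< l j<l))
      (trans (cong (2 +_) (+-comm _ 3)) (cong (4 +_) (∑<-≢ᵇ l j<l)))

    deg-leafPend : ∀ {j} → j < l → degᴹ (leafPend j) ≡ 2
    deg-leafPend {j} j<l =
      ∑-enum (ind ∘ modelAdj (leafPend j)) refl
        (∑<-zero K (λ i<K → cong (λ X → ind (not (X ∧ false) ∧ (X ∨ false))) (leaf≢cycle j (s≤s i<K))))
        (∑<-zero K (λ i<K → cong (λ X → ind (not (X ∧ false) ∧ (X ∨ false))) (leaf≢cycle j (s≤s i<K))))
        refl (∑<-≡ᵇ-< l j<l)
        (∑<-zero l (λ {j′} _ →
          trans (cong (λ X → ind (not (X ∧ (j ≡ᵇ j′)) ∧ (X ∨ (j ≡ᵇ j′)))) (≡ᵇ-+ k j j′)) (xor-self (j ≡ᵇ j′))))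
        refl (∑<-≡ᵇ-< l j<l)

    deg-hubCut : degᴹ hubCut ≡ 2 + l
    deg-hubCut = trans
      (∑-enum (ind ∘ modelAdj hubCut) refl (∑<-zero K (λ _ → refl)) (∑<-zero K (λ _ → refl)) refl
        (∑<-one l (λ _ → refl)) (∑<-zero l (λ _ → refl)) refl (∑<-zero l (λ _ → refl)))
      (cong (2 +_) (+-identityʳ l))

    deg-pendCut : ∀ {j} → j < l → degᴹ (pendCut j) ≡ 2
    deg-pendCut {j} j<l =
      ∑-enum (ind ∘ modelAdj (pendCut j)) refl (∑<-zero K (λ _ → refl)) (∑<-zero K (λ _ → refl)) refl
        (∑<-≡ᵇ-< l j<l) (∑<-≡ᵇ-< l j<l) refl
        (∑<-zero l (λ {j′} _ → cong ind (∧-zeroʳ (not (j ≡ᵇ j′)))))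

    data ModelVertex : LVertex → Set where
      hubCyc₀ᵛ  : ModelVertex hubCyc₀
      cycFwdᵛ   : ∀ {i} → i < K → ModelVertex (cycFwd i)
      cycBwdᵛ   : ∀ {i} → i < K → ModelVertex (cycBwd i)
      hubCycKᵛ  : ModelVertex hubCycK
      hubPendᵛ  : ∀ {j} → j < l → ModelVertex (hubPend j)
      leafPendᵛ : ∀ {j} → j < l → ModelVertex (leafPend j)
      hubCutᵛ   : ModelVertex hubCut
      pendCutᵛ  : ∀ {j} → j < l → ModelVertex (pendCut j)

    ∈enum⇒ModelVertex : ∀ {c} → c ∈ enum → ModelVertex c
    ∈enum⇒ModelVertex (here refl) = hubCyc₀ᵛ
    ∈enum⇒ModelVertex (there c∈)
      with ∈-++⁻ (applyUpTo cycFwd K) c∈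
    ... | inj₁ c∈₁ with ∈-applyUpTo⁻ cycFwd c∈₁
    ...   | _ , i<K , refl = cycFwdᵛ i<K
    ∈enum⇒ModelVertex (there c∈) | inj₂ c∈₁
      with ∈-++⁻ (applyUpTo cycBwd K) c∈₁
    ... | inj₁ c∈₂ with ∈-applyUpTo⁻ cycBwd c∈₂
    ...   | _ , i<K , refl = cycBwdᵛ i<K
    ∈enum⇒ModelVertex (there c∈) | inj₂ c∈₁ | inj₂ (here refl) = hubCycKᵛ
    ∈enum⇒ModelVertex (there c∈) | inj₂ c∈₁ | inj₂ (there c∈₂)
      with ∈-++⁻ (applyUpTo hubPend l) c∈₂
    ... | inj₁ c∈₃ with ∈-applyUpTo⁻ hubPend c∈₃
    ...   | _ , j<l , refl = hubPendᵛ j<l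
    ∈enum⇒ModelVertex (there c∈) | inj₂ c∈₁ | inj₂ (there c∈₂) | inj₂ c∈₃
      with ∈-++⁻ (applyUpTo leafPend l) c∈₃
    ... | inj₁ c∈₄ with ∈-applyUpTo⁻ leafPend c∈₄
    ...   | _ , j<l , refl = leafPendᵛ j<l
    ∈enum⇒ModelVertex (there c∈) | inj₂ c∈₁ | inj₂ (there c∈₂) | inj₂ c∈₃ | inj₂ (here refl) = hubCutᵛ
    ∈enum⇒ModelVertex (there c∈) | inj₂ c∈₁ | inj₂ (there c∈₂) | inj₂ c∈₃ | inj₂ (there c∈₄)
      with ∈-applyUpTo⁻ pendCut c∈₄
    ... | _ , j<l , refl = pendCutᵛ j<l

    ModelVertex⇒∈enum : ∀ {c} → ModelVertex c → c ∈ enum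
    ModelVertex⇒∈enum hubCyc₀ᵛ       = here refl
    ModelVertex⇒∈enum (cycFwdᵛ i<K)  = there (∈-++⁺ˡ (∈-applyUpTo⁺ cycFwd i<K))
    ModelVertex⇒∈enum (cycBwdᵛ i<K)  = there (∈-++⁺ʳ (applyUpTo cycFwd K) (∈-++⁺ˡ (∈-applyUpTo⁺ cycBwd i<K)))
    ModelVertex⇒∈enum hubCycKᵛ       = there (∈-++⁺ʳ (applyUpTo cycFwd K) (∈-++⁺ʳ (applyUpTo cycBwd K) (here refl)))
    ModelVertex⇒∈enum (hubPendᵛ j<l) = there (∈-++⁺ʳ (applyUpTo cycFwd K) (∈-++⁺ʳ (applyUpTo cycBwd K) (there
      (∈-++⁺ˡ (∈-applyUpTo⁺ hubPend j<l)))))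
    ModelVertex⇒∈enum (leafPendᵛ j<l) = there (∈-++⁺ʳ (applyUpTo cycFwd K) (∈-++⁺ʳ (applyUpTo cycBwd K) (there
      (∈-++⁺ʳ (applyUpTo hubPend l) (∈-++⁺ˡ (∈-applyUpTo⁺ leafPend j<l))))))
    ModelVertex⇒∈enum hubCutᵛ        = there (∈-++⁺ʳ (applyUpTo cycFwd K) (∈-++⁺ʳ (applyUpTo cycBwd K) (there
      (∈-++⁺ʳ (applyUpTo hubPend l) (∈-++⁺ʳ (applyUpTo leafPend l) (here refl))))))
    ModelVertex⇒∈enum (pendCutᵛ j<l) = there (∈-++⁺ʳ (applyUpTo cycFwd K) (∈-++⁺ʳ (applyUpTo cycBwd K) (there
      (∈-++⁺ʳ (applyUpTo hubPend l) (∈-++⁺ʳ (applyUpTo leafPend l) (there (∈-applyUpTo⁺ pendCut j<l)))))))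

    multiplicity≡1 : ∀ {c} → ModelVertex c → multiplicity c ≡ 1
    multiplicity≡1 hubCyc₀ᵛ =
      ∑-enum (ind ∘ does ∘ (hubCyc₀ ≟ᴸ_)) refl (∑<-zero K (λ _ → refl)) (∑<-zero K (λ _ → refl)) refl
        (∑<-zero l (λ _ → refl)) (∑<-zero l (λ _ → refl)) refl (∑<-zero l (λ _ → refl))
    multiplicity≡1 (cycFwdᵛ {i} i<K) =
      ∑-enum (ind ∘ does ∘ (cycFwd i ≟ᴸ_)) refl
        (trans (∑<-cong K (λ {i′} _ → cong ind (∧-idem (i ≡ᵇ i′)))) (∑<-≡ᵇ-< K i<K))
        (∑<-zero K (λ {i′} _ → cong ind (≡ᵇ-suc-disjointˡ i i′))) refl
        (∑<-zero l (λ _ → refl)) (∑<-zero l (λ {j} _ → cong ind (∧-zeroʳ (suc i ≡ᵇ k + j)))) refl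
        (∑<-zero l (λ _ → refl))
    multiplicity≡1 (cycBwdᵛ {i} i<K) =
      ∑-enum (ind ∘ does ∘ (cycBwd i ≟ᴸ_)) refl
        (∑<-zero K (λ {i′} _ → cong ind (≡ᵇ-suc-disjointʳ i i′)))
        (trans (∑<-cong K (λ {i′} _ → cong ind (∧-idem (i ≡ᵇ i′)))) (∑<-≡ᵇ-< K i<K)) refl
        (∑<-zero l (λ _ → refl)) (∑<-zero l (λ {j} _ → cong ind (∧-zeroʳ (suc i ≡ᵇ k + j)))) refl
        (∑<-zero l (λ _ → refl))
    multiplicity≡1 hubCycKᵛ =
      ∑-enum (ind ∘ does ∘ (hubCycK ≟ᴸ_)) refl (∑<-zero K (λ _ → refl)) (∑<-zero K (λ _ → refl))
        (cong ind (dec-true (k′ ≟ k′) refl))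
        (∑<-zero l (λ _ → refl)) (∑<-zero l (λ _ → refl)) refl (∑<-zero l (λ _ → refl))
    multiplicity≡1 (hubPendᵛ j<l) =
      ∑-enum (ind ∘ does ∘ (hubPend _ ≟ᴸ_)) refl (∑<-zero K (λ _ → refl)) (∑<-zero K (λ _ → refl)) refl
        (∑<-≡ᵇ-< l j<l) (∑<-zero l (λ _ → refl)) refl (∑<-zero l (λ _ → refl))
    multiplicity≡1 (leafPendᵛ {j} j<l) =
      ∑-enum (ind ∘ does ∘ (leafPend j ≟ᴸ_)) refl
        (∑<-zero K (λ {i} _ → cong ind (∧-zeroʳ (k + j ≡ᵇ suc i))))
        (∑<-zero K (λ {i} _ → cong ind (∧-zeroʳ (k + j ≡ᵇ suc i)))) refl
        (∑<-zero l (λ _ → refl))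
        (trans (∑<-cong l (λ {j′} _ →
                  cong ind (trans (cong (_∧ (j ≡ᵇ j′)) (≡ᵇ-+ k j j′)) (∧-idem (j ≡ᵇ j′)))))
               (∑<-≡ᵇ-< l j<l))
        refl (∑<-zero l (λ _ → refl))
    multiplicity≡1 hubCutᵛ =
      ∑-enum (ind ∘ does ∘ (hubCut ≟ᴸ_)) refl (∑<-zero K (λ _ → refl)) (∑<-zero K (λ _ → refl)) refl
        (∑<-zero l (λ _ → refl)) (∑<-zero l (λ _ → refl)) refl (∑<-zero l (λ _ → refl))
    multiplicity≡1 (pendCutᵛ j<l) =
      ∑-enum (ind ∘ does ∘ (pendCut _ ≟ᴸ_)) refl (∑<-zero K (λ _ → refl)) (∑<-zero K (λ _ → refl)) refl
        (∑<-zero l (λ _ → refl)) (∑<-zero l (λ _ → refl)) refl (∑<-≡ᵇ-< l j<l)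

    size : length enum ≡ 2 * k′ + 3 * l + 7
    size = begin
      length enum
        ≡⟨ sym (∑-one enum) ⟩
      ∑[ _ ← enum ] 1
        ≡⟨ ∑-enum (λ _ → 1) refl (∑<-one K (λ _ → refl)) (∑<-one K (λ _ → refl)) refl
                  (∑<-one l (λ _ → refl)) (∑<-one l (λ _ → refl)) refl (∑<-one l (λ _ → refl)) ⟩
      1 + ((2 + k′) + ((2 + k′) + (1 + (l + (l + (1 + l))))))
        ≡⟨ solve (k′ ∷ l ∷ []) ⟩
      2 * k′ + 3 * l + 7 ∎
      where open ≡-Reasoning

    private
      term : LVertex → ℕ
      term c = degᴹ c * (length enum ∸ suc (degᴹ c))

      term-value : ∀ c d e → degᴹ c ≡ d → suc d + e ≡ 2 * k′ + 3 * l + 7 → term c ≡ d * e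
      term-value c d e refl eq =
        cong (d *_) (trans (cong (_∸ suc d) (trans size (sym eq))) (m+n∸m≡n (suc d) e))

      term-2 : ∀ c → degᴹ c ≡ 2 → term c ≡ 2 * (2 * k′ + 3 * l + 4)
      term-2 c eq = term-value c 2 (2 * k′ + 3 * l + 4) eq (solve (k′ ∷ l ∷ []))

      term-2+l : ∀ c → degᴹ c ≡ 2 + l → term c ≡ (2 + l) * (2 * k′ + 2 * l + 4)
      term-2+l c eq = term-value c (2 + l) (2 * k′ + 2 * l + 4) eq (solve (k′ ∷ l ∷ []))

      term-3+l : ∀ c → degᴹ c ≡ 3 + l → term c ≡ (3 + l) * (2 * k′ + 2 * l + 3)
      term-3+l c eq = term-value c (3 + l) (2 * k′ + 2 * l + 3) eq (solve (k′ ∷ l ∷ []))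

      term-4+l : ∀ c → degᴹ c ≡ 4 + l → term c ≡ (4 + l) * (2 * k′ + 2 * l + 2)
      term-4+l c eq = term-value c (4 + l) (2 * k′ + 2 * l + 2) eq (solve (k′ ∷ l ∷ []))

    coindexᴹ≡polynomial : ∑[ c ← enum ] degᴹ c * (length enum ∸ suc (degᴹ c))
      ≡ 58 + 74 * l + 28 * l * l + 2 * l * l * l + 48 * k′ + 34 * k′ * l + 2 * k′ * l * l + 8 * k′ * k′
    coindexᴹ≡polynomial = begin
      ∑ enum term
        ≡⟨ ∑-enum term (term-3+l hubCyc₀ deg-hubCyc₀)
             (∑<-const K _ (λ {i} i<K → term-2 (cycFwd i) (deg-cycFwd i<K)))
             (∑<-const K _ (λ {i} i<K → term-2 (cycBwd i) (deg-cycBwd i<K)))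
             (term-3+l hubCycK deg-hubCycK)
             (∑<-const l _ (λ {j} j<l → term-4+l (hubPend j) (deg-hubPend j<l)))
             (∑<-const l _ (λ {j} j<l → term-2 (leafPend j) (deg-leafPend j<l)))
             (term-2+l hubCut deg-hubCut)
             (∑<-const l _ (λ {j} j<l → term-2 (pendCut j) (deg-pendCut j<l))) ⟩
      (3 + l) * (2 * k′ + 2 * l + 3)
        + ((2 + k′) * (2 * (2 * k′ + 3 * l + 4))
        + ((2 + k′) * (2 * (2 * k′ + 3 * l + 4))
        + ((3 + l) * (2 * k′ + 2 * l + 3)
        + (l * ((4 + l) * (2 * k′ + 2 * l + 2))
        + (l * (2 * (2 * k′ + 3 * l + 4))
        + ((2 + l) * (2 * k′ + 2 * l + 4)
        + l * (2 * (2 * k′ + 3 * l + 4))))))))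
        ≡⟨ solve (k′ ∷ l ∷ []) ⟩
      58 + 74 * l + 28 * l * l + 2 * l * l * l + 48 * k′ + 34 * k′ * l + 2 * k′ * l * l + 8 * k′ * k′ ∎
      where open ≡-Reasoning

  module Subdivision (k′ l : ℕ) {M : ℕ} (S : Graph M) (IS : IsSubdivision (CS (3 + k′) l) S) where

    open Model k′ l using (K; k)
    open IsSubdivision IS

    n : ℕ
    n = k + l

    data Arc (i j : ℕ) : Set where
      forward : suc i ≡ j → j < k → Arc i j
      closing : j ≡ 0 → suc i ≡ k → Arc i j
      outward : i ≡ 0 → k ≤ j → Arc i j

    arc-sound : ∀ i j → T (csArc k i j) → Arc i j
    arc-sound i j = decide (i <? k) (j <? k) (suc i ≟ j) (j ≟ 0) (suc i ≟ k) (i ≟ 0)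
      where
      -- the body of csArc k i j, with its six tests as parameters
      decide : (a : Dec (i < k)) (b : Dec (j < k)) (c : Dec (suc i ≡ j)) (d : Dec (j ≡ 0))
               (e : Dec (suc i ≡ k)) (f : Dec (i ≡ 0)) →
               T ((does a ∧ does b ∧ (does c ∨ (does d ∧ does e))) ∨ (does f ∧ not (does b))) → Arc i j
      decide (yes _) (yes j<k) (yes si≡j) _         _          _       _  = forward si≡j j<k
      decide (yes _) (yes _)   (no _)     (yes j≡0) (yes si≡k) _       _  = closing j≡0 si≡k
      decide _       (no j≮k)  _          _         _          (yes i≡0) _ = outward i≡0 (≮⇒≥ j≮k)
      decide (yes _) (yes _)   (no _)     (yes _)   (no _)     (yes _) ()
      decide (yes _) (yes _)   (no _)     (yes _)   (no _)     (no _)  ()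
      decide (yes _) (yes _)   (no _)     (no _)    _          (yes _) ()
      decide (yes _) (yes _)   (no _)     (no _)    _          (no _)  ()
      decide (yes _) (no _)    _          _         _          (no _)  ()
      decide (no _)  (no _)    _          _         _          (no _)  ()
      decide (no _)  (yes _)   _          _         _          (yes _) ()
      decide (no _)  (yes _)   _          _         _          (no _)  ()

    arc-complete : ∀ {i j} → Arc i j → T (csArc k i j)
    arc-complete {i} (forward refl j<k)
      rewrite dec-true (i <? k) (<-trans (n<1+n i) j<k) | dec-true (suc i <? k) j<k | dec-true (suc i ≟ suc i) refl = tt
    arc-complete {i} (closing refl refl) rewrite dec-true (i <? k) (n<1+n i) | dec-true (k′ ≟ k′) refl = tt
    arc-complete {j = j} (outward refl k≤j) rewrite dec-false (j <? k) (λ j<k → <-irrefl refl (≤-trans j<k k≤j)) = tt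

    H : Graph n
    H = CS k l

    data CSEdge (p q : ℕ) : Set where
      cycle : suc p ≡ q → q < k → CSEdge p q
      wrap  : p ≡ 0 → q ≡ K → CSEdge p q
      spoke : p ≡ 0 → k ≤ q → CSEdge p q

    private
      ≮0 : ∀ {x y} → x < y → y ≢ 0
      ≮0 () refl

    edge-classify : ∀ {p q} → IsEdge H (p , q) → CSEdge (toℕ p) (toℕ q)
    edge-classify (p<q , t) with to T-∨ (proj₂ (to T-∧ t))
    ... | inj₁ t₁ with arc-sound _ _ t₁
    ...   | forward si≡q q<k = cycle si≡q q<k
    ...   | closing q≡0 _    = ⊥-elim (≮0 p<q q≡0)
    ...   | outward p≡0 k≤q  = spoke p≡0 k≤q
    edge-classify (p<q , t) | inj₂ t₂ with arc-sound _ _ t₂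
    ...   | forward sq≡p _   = ⊥-elim (<-irrefl refl (<-trans p<q (subst (_ <_) sq≡p (n<1+n _))))
    ...   | closing p≡0 sq≡k = wrap p≡0 (suc-injective sq≡k)
    ...   | outward q≡0 _    = ⊥-elim (≮0 p<q q≡0)

    CSEdge-< : ∀ {p q} → CSEdge p q → p < q
    CSEdge-< {p} (cycle refl _) = n<1+n p
    CSEdge-< (wrap refl refl)   = z<s
    CSEdge-< (spoke refl k≤q)   = ≤-trans z<s k≤q

    CSEdge⇒IsEdge : ∀ {p q} → CSEdge (toℕ p) (toℕ q) → IsEdge H (p , q)
    CSEdge⇒IsEdge {p} {q} e =
      CSEdge-< e , from T-∧ (distinct , from T-∨ (arcs e))
      where
      distinct : T (not (does (p ≟ᶠ q)))
      distinct rewrite dec-false (p ≟ᶠ q) (λ { refl → <-irrefl refl (CSEdge-< e) }) = tt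
      arcs : CSEdge (toℕ p) (toℕ q) → T (csArc k (toℕ p) (toℕ q)) ⊎ T (csArc k (toℕ q) (toℕ p))
      arcs (cycle si≡q q<k) = inj₁ (arc-complete (forward si≡q q<k))
      arcs (wrap p≡0 q≡K)   = inj₂ (arc-complete (closing p≡0 (cong suc q≡K)))
      arcs (spoke p≡0 k≤q)  = inj₁ (arc-complete (outward p≡0 k≤q))

    -- the subdivision vertex of a CS-edge {p, q} with p < q
    edgeLabel : ℕ → ℕ → SVertex
    edgeLabel p q = if q <ᵇ k then (if suc p ≡ᵇ q then cyc p else cyc q) else pend (q ∸ k)

    classLabel : ∀ {p q} → CSEdge p q → SVertex
    classLabel {p} (cycle _ _)     = cyc p
    classLabel (wrap _ _)          = cyc K
    classLabel {q = q} (spoke _ _) = pend (q ∸ k)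

    edgeLabel≡classLabel : ∀ {p q} (e : CSEdge p q) → edgeLabel p q ≡ classLabel e
    edgeLabel≡classLabel {p} (cycle refl q<k)
      rewrite dec-true (suc p <? k) q<k | dec-true (p ≟ p) refl = refl
    edgeLabel≡classLabel (wrap refl refl) rewrite dec-true (k′ <? suc k′) (n<1+n k′) = refl
    edgeLabel≡classLabel {q = q} (spoke refl k≤q)
      rewrite dec-false (q <? k) (λ q<k → <-irrefl refl (≤-trans q<k k≤q)) = refl

    toSVertex : Fin n ⊎ (Fin n × Fin n) → SVertex
    toSVertex (inj₁ v)       = orig (toℕ v)
    toSVertex (inj₂ (p , q)) = edgeLabel (toℕ p) (toℕ q)

    label : Fin M → SVertex
    label = toSVertex ∘ g

    data View (a : Fin M) : Set where
      ofVertex : ∀ v → g a ≡ inj₁ v → View a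
      ofEdge : ∀ p q → g a ≡ inj₂ (p , q) → CSEdge (toℕ p) (toℕ q) → View a

    view : ∀ a → View a
    view a with g a in eq
    ... | inj₁ v       = ofVertex v eq
    ... | inj₂ (p , q) = ofEdge p q eq (edge-classify (to (g-edge (p , q)) (a , eq)))

    label-vertex : ∀ {a v} → g a ≡ inj₁ v → label a ≡ orig (toℕ v)
    label-vertex eq = cong toSVertex eq

    label-edge : ∀ {a p q} → g a ≡ inj₂ (p , q) → (e : CSEdge (toℕ p) (toℕ q)) → label a ≡ classLabel e
    label-edge eq e = trans (cong toSVertex eq) (edgeLabel≡classLabel e)

    Valid : SVertex → Set
    Valid (orig v) = v < n
    Valid (cyc i)  = i < k
    Valid (pend j) = j < l

    leaf-index : ∀ {x} → k ≤ x → x < n → x ∸ k < l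
    leaf-index {x} k≤x x<n = +-cancelˡ-< k (x ∸ k) l (subst (_< n) (sym (m+[n∸m]≡n k≤x)) x<n)

    classLabel-valid : ∀ {p q} (e : CSEdge p q) → q < n → Valid (classLabel e)
    classLabel-valid {p} (cycle refl q<k) _ = <-trans (n<1+n p) q<k
    classLabel-valid (wrap _ _) _           = n<1+n K
    classLabel-valid (spoke _ k≤q) q<n      = leaf-index k≤q q<n

    label-valid : ∀ a → Valid (label a)
    label-valid a with view a
    ... | ofVertex v eq    = subst Valid (sym (label-vertex eq)) (toℕ<n v)
    ... | ofEdge p q eq e  = subst Valid (sym (label-edge eq e)) (classLabel-valid e (toℕ<n q))

    -- v is an end of the CS-edge subdivided by s
    IsEnd : ℕ → SVertex → Set
    IsEnd v (orig _) = ⊥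
    IsEnd v (cyc i)  = v ≡ i ⊎ (suc i < k × v ≡ suc i) ⊎ (v ≡ 0 × i ≡ K)
    IsEnd v (pend j) = v ≡ 0 ⊎ v ≡ k + j

    SAdj : SVertex → SVertex → Set
    SAdj (orig v) s        = IsEnd v s
    SAdj s        (orig v) = IsEnd v s
    SAdj _        _        = ⊥

    SAdj-sym : ∀ s t → SAdj s t → SAdj t s
    SAdj-sym (orig v) (orig w) ()
    SAdj-sym (orig v) (cyc i)  inc = inc
    SAdj-sym (orig v) (pend j) inc = inc
    SAdj-sym (cyc i)  (orig v) inc = inc
    SAdj-sym (pend j) (orig v) inc = inc

    SAdj-kinds : ∀ s t → SAdj s t → not (isOrig s) ≡ isOrig t
    SAdj-kinds (orig _) (cyc _)  _ = refl
    SAdj-kinds (orig _) (pend _) _ = refl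
    SAdj-kinds (cyc _)  (orig _) _ = refl
    SAdj-kinds (pend _) (orig _) _ = refl

    classLabel-notOrig : ∀ {p q} (e : CSEdge p q) → isOrig (classLabel e) ≡ false
    classLabel-notOrig (cycle _ _) = refl
    classLabel-notOrig (wrap _ _)  = refl
    classLabel-notOrig (spoke _ _) = refl

    isEnd⁺ : ∀ {v p q : Fin n} (e : CSEdge (toℕ p) (toℕ q)) → v ≡ p ⊎ v ≡ q → IsEnd (toℕ v) (classLabel e)
    isEnd⁺ (cycle si≡q q<k) (inj₁ refl) = inj₁ refl
    isEnd⁺ (cycle si≡q q<k) (inj₂ refl) = inj₂ (inj₁ (subst (_< k) (sym si≡q) q<k , sym si≡q))
    isEnd⁺ (wrap p≡0 q≡K)   (inj₁ refl) = inj₂ (inj₂ (p≡0 , refl))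
    isEnd⁺ (wrap p≡0 q≡K)   (inj₂ refl) = inj₁ q≡K
    isEnd⁺ (spoke p≡0 k≤q)  (inj₁ refl) = inj₁ p≡0
    isEnd⁺ (spoke p≡0 k≤q)  (inj₂ refl) = inj₂ (sym (m+[n∸m]≡n k≤q))

    isEnd⁻ : ∀ {v p q : Fin n} (e : CSEdge (toℕ p) (toℕ q)) → IsEnd (toℕ v) (classLabel e) → v ≡ p ⊎ v ≡ q
    isEnd⁻ (cycle si≡q q<k) (inj₁ v≡p)                = inj₁ (toℕ-injective v≡p)
    isEnd⁻ (cycle si≡q q<k) (inj₂ (inj₁ (_ , v≡sp)))  = inj₂ (toℕ-injective (trans v≡sp si≡q))
    isEnd⁻ (cycle si≡q q<k) (inj₂ (inj₂ (_ , p≡K)))   = ⊥-elim (<-irrefl (trans (sym si≡q) (cong suc p≡K)) q<k)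
    isEnd⁻ (wrap p≡0 q≡K)   (inj₁ v≡K)                = inj₂ (toℕ-injective (trans v≡K (sym q≡K)))
    isEnd⁻ (wrap p≡0 q≡K)   (inj₂ (inj₁ (sK<k , _)))  = ⊥-elim (<-irrefl refl sK<k)
    isEnd⁻ (wrap p≡0 q≡K)   (inj₂ (inj₂ (v≡0 , _)))   = inj₁ (toℕ-injective (trans v≡0 (sym p≡0)))
    isEnd⁻ (spoke p≡0 k≤q)  (inj₁ v≡0)                = inj₁ (toℕ-injective (trans v≡0 (sym p≡0)))
    isEnd⁻ (spoke p≡0 k≤q)  (inj₂ v≡k+j)              = inj₂ (toℕ-injective (trans v≡k+j (m+[n∸m]≡n k≤q)))

    SAdj-classLabel : ∀ {p q p′ q′} (e : CSEdge p q) (e′ : CSEdge p′ q′) → ¬ SAdj (classLabel e) (classLabel e′)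
    SAdj-classLabel e e′ adj =
      case trans (cong not (sym (classLabel-notOrig e))) (trans (SAdj-kinds _ _ adj) (classLabel-notOrig e′)) of λ ()

    adj⇒SAdj : ∀ {a b} → Adj S a b → SAdj (label a) (label b)
    adj⇒SAdj {a} {b} t with view a | view b | to (g-adj a b) t
    ... | ofVertex v ea   | ofVertex w eb   | s = ⊥-elim (subst₂ SubAdj ea eb s)
    ... | ofVertex v ea   | ofEdge p q eb e | s =
      subst₂ SAdj (sym (label-vertex ea)) (sym (label-edge eb e)) (isEnd⁺ e (subst₂ SubAdj ea eb s))
    ... | ofEdge p q ea e | ofVertex v eb   | s =
      subst₂ SAdj (sym (label-edge ea e)) (sym (label-vertex eb))
        (SAdj-sym (orig (toℕ v)) (classLabel e) (isEnd⁺ e (subst₂ SubAdj ea eb s)))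
    ... | ofEdge _ _ ea _ | ofEdge _ _ eb _ | s = ⊥-elim (subst₂ SubAdj ea eb s)

    SAdj⇒adj : ∀ {a b} → SAdj (label a) (label b) → Adj S a b
    SAdj⇒adj {a} {b} s with view a | view b
    ... | ofVertex v ea   | ofVertex w eb   = ⊥-elim (subst₂ SAdj (label-vertex ea) (label-vertex eb) s)
    ... | ofVertex v ea   | ofEdge p q eb e = from (g-adj a b)
      (subst₂ SubAdj (sym ea) (sym eb) (isEnd⁻ e (subst₂ SAdj (label-vertex ea) (label-edge eb e) s)))
    ... | ofEdge p q ea e | ofVertex v eb   = from (g-adj a b)
      (subst₂ SubAdj (sym ea) (sym eb)
        (isEnd⁻ e (SAdj-sym (classLabel e) (orig (toℕ v)) (subst₂ SAdj (label-edge ea e) (label-vertex eb) s))))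
    ... | ofEdge _ _ ea e | ofEdge _ _ eb e′ =
      ⊥-elim (SAdj-classLabel e e′ (subst₂ SAdj (label-edge ea e) (label-edge eb e′) s))

    classLabel≢orig : ∀ {p q} (e : CSEdge p q) {x} → classLabel e ≢ orig x
    classLabel≢orig e eq = case trans (sym (classLabel-notOrig e)) (cong isOrig eq) of λ ()

    classLabel-injective : ∀ {p q p′ q′} (e : CSEdge p q) (e′ : CSEdge p′ q′) →
                           classLabel e ≡ classLabel e′ → p ≡ p′ × q ≡ q′
    classLabel-injective (cycle sp≡q _) (cycle sp≡q′ _) refl = refl , trans (sym sp≡q) sp≡q′
    classLabel-injective (cycle sp≡q q<k) (wrap _ _) refl    = ⊥-elim (<-irrefl (sym sp≡q) q<k)
    classLabel-injective (wrap _ _) (cycle sp≡q q<k) refl    = ⊥-elim (<-irrefl (sym sp≡q) q<k)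
    classLabel-injective (wrap p≡0 q≡K) (wrap p′≡0 q′≡K) _   = trans p≡0 (sym p′≡0) , trans q≡K (sym q′≡K)
    classLabel-injective (spoke p≡0 k≤q) (spoke p′≡0 k≤q′) eq =
      trans p≡0 (sym p′≡0) , trans (sym (m+[n∸m]≡n k≤q)) (trans (cong (k +_) (pend-injective eq)) (m+[n∸m]≡n k≤q′))

    label-injective : ∀ {a b} → label a ≡ label b → a ≡ b
    label-injective {a} {b} eq with view a | view b
    ... | ofVertex v ea   | ofVertex w eb   =
      g-inj a b (trans ea (trans (cong inj₁ (toℕ-injective (orig-injective eq′))) (sym eb)))
      where eq′ = trans (sym (label-vertex ea)) (trans eq (label-vertex eb))
    ... | ofVertex v ea   | ofEdge p q eb e =
      ⊥-elim (classLabel≢orig e (sym (trans (sym (label-vertex ea)) (trans eq (label-edge eb e)))))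
    ... | ofEdge p q ea e | ofVertex v eb   =
      ⊥-elim (classLabel≢orig e (trans (sym (label-edge ea e)) (trans eq (label-vertex eb))))
    ... | ofEdge p q ea e | ofEdge p′ q′ eb e′
      with classLabel-injective e e′ (trans (sym (label-edge ea e)) (trans eq (label-edge eb e′)))
    ...   | p≡p′ , q≡q′ =
      g-inj a b (trans ea (trans (cong inj₂ (cong₂ _,_ (toℕ-injective p≡p′) (toℕ-injective q≡q′))) (sym eb)))

    cycle<n : ∀ {i} → i < k → i < n
    cycle<n i<k = ≤-trans i<k (m≤m+n k l)

    private
      edge-onto : ∀ {p q} → p < n → q < n → (e : CSEdge p q) → ∃ λ a → label a ≡ classLabel e
      edge-onto p<n q<n e with fromℕ< p<n | toℕ-fromℕ< p<n | fromℕ< q<n | toℕ-fromℕ< q<n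
      ... | p | refl | q | refl with from (g-edge (p , q)) (CSEdge⇒IsEdge e)
      ...   | a , eq = a , label-edge eq e

    label-onto : ∀ s → Valid s → ∃ λ a → label a ≡ s
    label-onto (orig v) v<n with g-vertex (fromℕ< v<n)
    ... | a , eq = a , trans (label-vertex eq) (cong orig (toℕ-fromℕ< v<n))
    label-onto (cyc i) i<k with suc i <? k
    ... | yes si<k = edge-onto (cycle<n i<k) (cycle<n si<k) (cycle refl si<k)
    ... | no si≮k with edge-onto (cycle<n z<s) (cycle<n (n<1+n K)) (wrap refl refl)
    ...   | a , eq = a , trans eq (cong cyc (≤-antisym (≤-pred (≮⇒≥ si≮k)) (≤-pred i<k)))
    label-onto (pend j) j<l with edge-onto (cycle<n z<s) (+-monoʳ-< k j<l) (spoke refl (m≤m+n k j))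
    ... | a , eq = a , trans eq (cong pend (m+n∸m≡n k j))

    hub : Fin M
    hub = proj₁ (label-onto (orig 0) z<s)

    label-hub : label hub ≡ orig 0
    label-hub = proj₂ (label-onto (orig 0) z<s)

    NotPend : SVertex → Set
    NotPend s = ∀ j → s ≢ pend j

    -- position along the subdivided cycle orig 0, cyc 0, orig 1, cyc 1, …, orig K, cyc K
    rank : SVertex → ℕ
    rank (orig v) = 2 * v
    rank (cyc i)  = suc (2 * i)
    rank (pend _) = 0

    rank-injective : ∀ {s t} → NotPend s → NotPend t → rank s ≡ rank t → s ≡ t
    rank-injective {orig v} {orig w} _ _ eq = cong orig (*-cancelˡ-≡ v w 2 eq)
    rank-injective {orig v} {cyc i}  _ _ eq = ⊥-elim (even≢odd v i eq)
    rank-injective {cyc i}  {orig v} _ _ eq = ⊥-elim (even≢odd v i (sym eq))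
    rank-injective {cyc i}  {cyc i′} _ _ eq = cong cyc (*-cancelˡ-≡ i i′ 2 (suc-injective eq))
    rank-injective {pend j} np _ _ = ⊥-elim (np j refl)
    rank-injective {orig _} {pend j} _ np _ = ⊥-elim (np j refl)
    rank-injective {cyc _}  {pend j} _ np _ = ⊥-elim (np j refl)

    -- Deleting a vertex c other than the hub and the pend j leaves S connected: a vertex of smaller rank than c
    -- walks down the cycle to 0, one of larger rank walks up to cyc K, which is adjacent to 0, and a leaf reaches 0
    -- through its pend vertex.
    module NonCut (c : Fin M) (c≢hub : label c ≢ orig 0) (c-notPend : NotPend (label c)) where

      Reaches : SVertex → Set
      Reaches s = ∀ {a} → label a ≡ s → ReachAvoid S c a hub

      reaches-hub : Reaches (orig 0)
      reaches-hub {a} la≡ = subst (λ b → ReachAvoid S c b hub) (label-injective (trans label-hub (sym la≡)))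
                                   (here (λ hub≡c → c≢hub (trans (cong label (sym hub≡c)) label-hub)))

      reaches-step : ∀ {s} t → label c ≢ s → SAdj s t → Valid t → Reaches t → Reaches s
      reaches-step t c≢s st vt reaches-t {a} la≡s with label-onto _ vt
      ... | b , lb≡t = step (λ a≡c → c≢s (trans (cong label (sym a≡c)) la≡s))
                            (SAdj⇒adj (subst₂ SAdj (sym la≡s) (sym lb≡t) st)) (reaches-t lb≡t)

      ≢-by-rank : ∀ {s} → rank s ≢ rank (label c) → label c ≢ s
      ≢-by-rank ne eq = ne (cong rank (sym eq))

      walk-down : ∀ v → v < k → 2 * v < rank (label c) → Reaches (orig v)
      walk-down zero    _    _  = reaches-hub
      walk-down (suc v) sv<k lt =
        reaches-step (cyc v) (≢-by-rank (<⇒≢ lt)) (inj₂ (inj₁ (sv<k , refl))) v<k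
          (reaches-step (orig v) (≢-by-rank (<⇒≢ lt′)) (inj₁ refl) (cycle<n v<k)
            (walk-down v v<k (<-trans (n<1+n _) lt′)))
        where
        v<k = <-trans (n<1+n v) sv<k
        lt′ : suc (2 * v) < rank (label c)
        lt′ = <-trans (subst (suc (2 * v) <_) (sym (*-suc 2 v)) (n<1+n _)) lt

      walk-up : ∀ d i → i + d ≡ K → rank (label c) < suc (2 * i) → Reaches (cyc i)
      walk-up zero    i eq gt =
        reaches-step (orig 0) (≢-by-rank (>⇒≢ gt)) (inj₂ (inj₂ (refl , trans (sym (+-identityʳ i)) eq))) z<s reaches-hub
      walk-up (suc d) i eq gt =
        reaches-step (orig (suc i)) (≢-by-rank (>⇒≢ gt)) (inj₂ (inj₁ (si<k , refl))) (cycle<n si<k)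
          (reaches-step (cyc (suc i)) (≢-by-rank (>⇒≢ gt′)) (inj₁ refl) si<k
            (walk-up d (suc i) (trans (sym (+-suc i d)) eq) gt″))
        where
        si<k : suc i < k
        si<k = s≤s (subst (suc i ≤_) eq (subst (suc i ≤_) (sym (+-suc i d)) (s≤s (m≤m+n i d))))
        gt′ : rank (label c) < 2 * suc i
        gt′ = <-trans gt (subst (suc (2 * i) <_) (sym (*-suc 2 i)) (n<1+n _))
        gt″ : rank (label c) < suc (2 * suc i)
        gt″ = <-trans gt′ (n<1+n _)

      reaches : ∀ s → Valid s → label c ≢ s → Reaches s
      reaches (orig v) v<n c≢s with v <? k
      ... | yes v<k with <-cmp (2 * v) (rank (label c))
      ...   | tri< lt _ _ = walk-down v v<k lt
      ...   | tri≈ _ eq _ = ⊥-elim (c≢s (rank-injective c-notPend (λ _ ()) (sym eq)))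
      ...   | tri> _ _ gt = reaches-step (cyc v) c≢s (inj₁ refl) v<k
                              (walk-up (K ∸ v) v (m+[n∸m]≡n (≤-pred v<k)) (<-trans gt (n<1+n _)))
      reaches (orig v) v<n c≢s | no v≮k =
        reaches-step (pend (v ∸ k)) c≢s (inj₂ (sym (m+[n∸m]≡n (≮⇒≥ v≮k)))) (leaf-index (≮⇒≥ v≮k) v<n)
          (reaches-step (orig 0) (c-notPend _) (inj₁ refl) z<s reaches-hub)
      reaches (cyc i) i<k c≢s with <-cmp (suc (2 * i)) (rank (label c))
      ... | tri< lt _ _ = reaches-step (orig i) c≢s (inj₁ refl) (cycle<n i<k) (walk-down i i<k (<-trans (n<1+n _) lt))
      ... | tri≈ _ eq _ = ⊥-elim (c≢s (rank-injective c-notPend (λ _ ()) (sym eq)))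
      ... | tri> _ _ gt = walk-up (K ∸ i) i (m+[n∸m]≡n (≤-pred i<k)) gt
      reaches (pend j) j<l c≢s = reaches-step (orig 0) c≢s (inj₁ refl) z<s reaches-hub

      reach-hub : ∀ u → u ≢ c → ReachAvoid S c u hub
      reach-hub u u≢c = reaches (label u) (label-valid u) (λ eq → u≢c (label-injective (sym eq))) refl

      not-cut : ¬ IsCutVertex S c
      not-cut (u , w , u≢c , w≢c , _ , ¬reach) =
        ¬reach (ReachAvoid-trans (reach-hub u u≢c) (ReachAvoid-sym (reach-hub w w≢c)))

    cut-label : ∀ {c} → IsCutVertex S c → label c ≡ orig 0 ⊎ ∃ λ j → label c ≡ pend j
    cut-label {c} is-cut with label c in eq
    ... | orig zero    = inj₁ refl
    ... | pend j       = inj₂ (j , refl)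
    ... | orig (suc v) = ⊥-elim (NonCut.not-cut c (λ e → case trans (sym eq) e of λ ())
                                                  (λ j e → case trans (sym eq) e of λ ()) is-cut)
    ... | cyc i        = ⊥-elim (NonCut.not-cut c (λ e → case trans (sym eq) e of λ ())
                                                  (λ j e → case trans (sym eq) e of λ ()) is-cut)

    label-≢ : ∀ {a b} → label a ≢ label b → a ≢ b
    label-≢ ne eq = ne (cong label eq)

    label≢hub : ∀ {a} → a ≢ hub → label a ≢ orig 0
    label≢hub a≢hub eq = a≢hub (label-injective (trans eq (sym label-hub)))

    hub-cut : 0 < l → IsCutVertex S hub
    hub-cut 0<l with label-onto (pend 0) 0<l | label-onto (cyc 0) z<s
    ... | u , lu | w , lw = cut-by-invariant P
      (label-≢ (λ eq → case trans (sym lu) (trans eq label-hub) of λ ()))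
      (label-≢ (λ eq → case trans (sym lw) (trans eq label-hub) of λ ()))
      (SAdj⇒adj (subst₂ SAdj (sym lu) (sym label-hub) (inj₁ refl)))
      (SAdj⇒adj (subst₂ SAdj (sym label-hub) (sym lw) (inj₁ refl)))
      (λ {a} {b} pa ab b≢hub → closed (label a) (label b) pa (adj⇒SAdj ab) (label-valid b) (label≢hub b≢hub))
      (inj₁ lu)
      (λ { (inj₁ eq) → case trans (sym lw) eq of λ () ; (inj₂ eq) → case trans (sym lw) eq of λ () })
      where
      -- the pendant path pend 0 – orig k hangs off the hub
      P : Fin M → Set
      P a = label a ≡ pend 0 ⊎ label a ≡ orig k
      closed : ∀ s t → s ≡ pend 0 ⊎ s ≡ orig k → SAdj s t → Valid t → t ≢ orig 0 → t ≡ pend 0 ⊎ t ≡ orig k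
      closed _ (orig v) (inj₁ refl) (inj₁ v≡0)   _ t≢hub = ⊥-elim (t≢hub (cong orig v≡0))
      closed _ (orig v) (inj₁ refl) (inj₂ v≡k+0) _ _     = inj₂ (cong orig (trans v≡k+0 (+-identityʳ k)))
      closed _ (cyc i)  (inj₂ refl) (inj₁ k≡i)                 i<k _ = ⊥-elim (<-irrefl (sym k≡i) i<k)
      closed _ (cyc i)  (inj₂ refl) (inj₂ (inj₁ (si<k , k≡si))) _ _ = ⊥-elim (<-irrefl (sym k≡si) si<k)
      closed _ (orig _) (inj₂ refl) ()
      closed _ (cyc _)  (inj₁ refl) ()
      closed _ (pend _) (inj₁ refl) ()
      closed _ (pend j) (inj₂ refl) (inj₂ k≡k+j) _ _ =
        inj₁ (cong pend (+-cancelˡ-≡ k j 0 (trans (sym k≡k+j) (sym (+-identityʳ k)))))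

    pend-cut : ∀ {j} (j<l : j < l) → IsCutVertex S (proj₁ (label-onto (pend j) j<l))
    pend-cut {j} j<l with label-onto (orig (k + j)) (+-monoʳ-< k j<l)
    ... | u , lu = cut-by-invariant (λ a → label a ≡ orig (k + j))
      (label-≢ (λ eq → case trans (sym lu) (trans eq lx) of λ ()))
      (label-≢ (λ eq → case trans (sym label-hub) (trans eq lx) of λ ()))
      (SAdj⇒adj (subst₂ SAdj (sym lu) (sym lx) (inj₂ refl)))
      (SAdj⇒adj (subst₂ SAdj (sym lx) (sym label-hub) (inj₁ refl)))
      (λ {a} {b} pa ab b≢x → ⊥-elim (isolated (label b) (subst (λ s → SAdj s (label b)) pa (adj⇒SAdj ab))
                                                (label-valid b) (λ eq → b≢x (label-injective (trans eq (sym lx))))))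
      lu
      (λ eq → case trans (sym label-hub) eq of λ ())
      where
      lx : label (proj₁ (label-onto (pend j) j<l)) ≡ pend j
      lx = proj₂ (label-onto (pend j) j<l)
      isolated : ∀ t → SAdj (orig (k + j)) t → Valid t → t ≢ pend j → ⊥
      isolated (cyc i)  (inj₁ k+j≡i) i<k _ =
        <-irrefl refl (≤-trans i<k (subst (k ≤_) k+j≡i (m≤m+n k j)))
      isolated (cyc i)  (inj₂ (inj₁ (si<k , k+j≡si))) _ _ =
        <-irrefl refl (≤-trans si<k (subst (k ≤_) k+j≡si (m≤m+n k j)))
      isolated (pend j′) (inj₂ k+j≡k+j′) _ t≢pend = t≢pend (cong pend (sym (+-cancelˡ-≡ k j j′ k+j≡k+j′)))

  module LineCutVertex (k′ l : ℕ) {M N : ℕ} (S : Graph M) (G : Graph N)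
    (0<l : 0 < l) (IS : IsSubdivision (CS (3 + k′) l) S) (IL : IsLineCutVertexGraph S G) where

    open Subdivision k′ l S IS
    open Model k′ l
    open IsLineCutVertexGraph IL

    origEnd subEnd : Fin M × Fin M → Fin M
    origEnd (a , b) = if isOrig (label a) then a else b
    subEnd  (a , b) = if isOrig (label a) then b else a

    Incident⇔ends : ∀ {z} e → Incident z e ⇔ (z ≡ origEnd e ⊎ z ≡ subEnd e)
    Incident⇔ends (a , b) with isOrig (label a)
    ... | true  = mk⇔ (λ inc → inc) (λ inc → inc)
    ... | false = mk⇔ swap swap

    end-kinds : ∀ {e} → IsEdge S e → T (isOrig (label (origEnd e))) × ¬ T (isOrig (label (subEnd e)))
    end-kinds {a , b} (_ , ab) with isOrig (label a) in eq | SAdj-kinds (label a) (label b) (adj⇒SAdj ab)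
    ... | true  | kb = subst T (sym eq) tt , subst T (sym kb)
    ... | false | kb = subst T kb tt , subst T eq

    ends-adjacent : ∀ {e} → IsEdge S e → Adj S (origEnd e) (subEnd e)
    ends-adjacent {a , b} (_ , ab) with isOrig (label a)
    ... | true  = ab
    ... | false = subst T (Graph.sym S a b) ab

    ends-injective : ∀ {e e′} → IsEdge S e → IsEdge S e′ →
                     origEnd e ≡ origEnd e′ → subEnd e ≡ subEnd e′ → e ≡ e′
    ends-injective {a , b} {a′ , b′} (a<b , _) (a′<b′ , _) o≡ m≡ with isOrig (label a) | isOrig (label a′)
    ... | true  | true  = cong₂ _,_ o≡ m≡
    ... | false | false = cong₂ _,_ m≡ o≡
    ... | true  | false = ⊥-elim (<-asym a<b (subst₂ (λ x y → toℕ x < toℕ y) (sym m≡) (sym o≡) a′<b′))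
    ... | false | true  = ⊥-elim (<-asym a<b (subst₂ (λ x y → toℕ x < toℕ y) (sym o≡) (sym m≡) a′<b′))

    code : (Fin M × Fin M) ⊎ Fin M → LVertex
    code (inj₁ e) = edge (label (origEnd e)) (label (subEnd e))
    code (inj₂ c) = cut (label c)

    π : Fin N → LVertex
    π = code ∘ f

    IsLcVertex : (Fin M × Fin M) ⊎ Fin M → Set
    IsLcVertex (inj₁ e) = IsEdge S e
    IsLcVertex (inj₂ c) = IsCutVertex S c

    f-valid : ∀ x → IsLcVertex (f x)
    f-valid x with f x in eq
    ... | inj₁ e = to (f-edge e) (x , eq)
    ... | inj₂ c = to (f-cut c) (x , eq)

    private
      edge-injective : ∀ {s t s′ t′} → edge s t ≡ edge s′ t′ → s ≡ s′ × t ≡ t′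
      edge-injective refl = refl , refl

      cut-injective : ∀ {s s′} → cut s ≡ cut s′ → s ≡ s′
      cut-injective refl = refl

    code-injective : ∀ {u v} → IsLcVertex u → IsLcVertex v → code u ≡ code v → u ≡ v
    code-injective {inj₁ e} {inj₁ e′} is-e is-e′ eq with edge-injective eq
    ... | o≡ , m≡ = cong inj₁ (ends-injective is-e is-e′ (label-injective o≡) (label-injective m≡))
    code-injective {inj₂ c} {inj₂ c′} _ _ eq = cong inj₂ (label-injective (cut-injective eq))

    π-injective : ∀ {x y} → π x ≡ π y → x ≡ y
    π-injective {x} {y} eq = f-inj x y (code-injective (f-valid x) (f-valid y) eq)

    edge-ModelVertex : ∀ {v} t → IsEnd v t → Valid t → ModelVertex (edge (orig v) t)
    edge-ModelVertex (cyc zero)    (inj₁ refl)                  _    = hubCyc₀ᵛ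
    edge-ModelVertex (cyc (suc i)) (inj₁ refl)                  si<k = cycFwdᵛ (≤-pred si<k)
    edge-ModelVertex (cyc i)       (inj₂ (inj₁ (si<k , refl)))  _    = cycBwdᵛ (≤-pred si<k)
    edge-ModelVertex (cyc i)       (inj₂ (inj₂ (refl , refl)))  _    = hubCycKᵛ
    edge-ModelVertex (pend j)      (inj₁ refl)                  j<l  = hubPendᵛ j<l
    edge-ModelVertex (pend j)      (inj₂ refl)                  j<l  = leafPendᵛ j<l

    code-ModelVertex : ∀ {u} → IsLcVertex u → ModelVertex (code u)
    code-ModelVertex {inj₁ e} is-e with label (origEnd e) in eq | proj₁ (end-kinds is-e)
    ... | orig v | _ = edge-ModelVertex (label (subEnd e))
                         (subst (λ s → SAdj s (label (subEnd e))) eq (adj⇒SAdj (ends-adjacent is-e)))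
                         (label-valid (subEnd e))
    code-ModelVertex {inj₂ c} is-cut with cut-label is-cut
    ... | inj₁ eq       = subst (ModelVertex ∘ cut) (sym eq) hubCutᵛ
    ... | inj₂ (j , eq) = subst (ModelVertex ∘ cut) (sym eq) (pendCutᵛ (subst Valid eq (label-valid c)))

    π-valid : ∀ x → ModelVertex (π x)
    π-valid x = code-ModelVertex (f-valid x)

    IsEnd-sub : ∀ {v} t → IsEnd v t → ¬ T (isOrig t)
    IsEnd-sub (cyc _)  _ ()
    IsEnd-sub (pend _) _ ()

    code-oriented : ∀ {a b} → T (isOrig (label a)) → code (inj₁ (a , b)) ≡ edge (label a) (label b)
    code-oriented {a} o with isOrig (label a)
    ... | true = refl

    code-reversed : ∀ {a b} → ¬ T (isOrig (label a)) → code (inj₁ (a , b)) ≡ edge (label b) (label a)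
    code-reversed {a} ¬o with isOrig (label a)
    ... | true  = ⊥-elim (¬o tt)
    ... | false = refl

    edge-onto : ∀ {v t} → IsEnd v t → v < n → Valid t → ∃ λ x → π x ≡ edge (orig v) t
    edge-onto {v} {t} inc v<n vt with label-onto (orig v) v<n | label-onto t vt
    ... | a , la | b , lb with <-cmp (toℕ a) (toℕ b)
    ...   | tri< a<b _ _ with from (f-edge (a , b)) (a<b , SAdj⇒adj (subst₂ SAdj (sym la) (sym lb) inc))
    ...     | x , fx = x , trans (cong code fx) (trans (code-oriented (subst (T ∘ isOrig) (sym la) tt)) (cong₂ edge la lb))
    edge-onto {v} {t} inc v<n vt | a , la | b , lb | tri≈ _ a≡b _ =
      ⊥-elim (subst T (Graph.irrefl S a)
        (subst (Adj S a) (sym (toℕ-injective a≡b)) (SAdj⇒adj (subst₂ SAdj (sym la) (sym lb) inc))))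
    edge-onto {v} {t} inc v<n vt | a , la | b , lb | tri> _ _ b<a
      with from (f-edge (b , a)) (b<a , SAdj⇒adj (subst₂ SAdj (sym lb) (sym la) (SAdj-sym (orig v) t inc)))
    ...     | x , fx = x , trans (cong code fx)
                               (trans (code-reversed (subst (λ s → ¬ T (isOrig s)) (sym lb) (IsEnd-sub t inc)))
                                      (cong₂ edge la lb))

    cut-onto : ∀ {c} → IsCutVertex S c → ∃ λ x → π x ≡ cut (label c)
    cut-onto {c} is-cut with from (f-cut c) is-cut
    ... | x , fx = x , cong code fx

    π-onto : ∀ {c} → ModelVertex c → ∃ λ x → π x ≡ c
    π-onto hubCyc₀ᵛ         = edge-onto (inj₁ refl) z<s z<s
    π-onto (cycFwdᵛ i<K)    = edge-onto (inj₁ refl) (cycle<n (s<s i<K)) (s<s i<K)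
    π-onto (cycBwdᵛ i<K)    = edge-onto (inj₂ (inj₁ (s<s i<K , refl))) (cycle<n (s<s i<K)) (m<n⇒m<1+n i<K)
    π-onto hubCycKᵛ         = edge-onto (inj₂ (inj₂ (refl , refl))) z<s (n<1+n K)
    π-onto (hubPendᵛ j<l)   = edge-onto (inj₁ refl) z<s j<l
    π-onto (leafPendᵛ j<l)  = edge-onto (inj₂ refl) (+-monoʳ-< k j<l) j<l
    π-onto hubCutᵛ with cut-onto (hub-cut 0<l)
    ... | x , eq = x , trans eq (cong cut label-hub)
    π-onto (pendCutᵛ j<l) with cut-onto (pend-cut j<l)
    ... | x , eq = x , trans eq (cong cut (proj₂ (label-onto (pend _) j<l)))

    T-≟-label : ∀ {a b} → T (does (label a ≟ˢ label b)) ⇔ a ≡ b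
    T-≟-label {a} {b} = ⇔-trans (T-does (label a ≟ˢ label b)) (mk⇔ label-injective (cong label))

    T-≟-label-∨ : ∀ {a b c d} → T (does (label a ≟ˢ label b) ∨ does (label c ≟ˢ label d)) ⇔ (a ≡ b ⊎ c ≡ d)
    T-≟-label-∨ = ⇔-trans T-∨ (T-≟-label ⊎-⇔ T-≟-label)

    ShareEnd⇔ends : ∀ {e e′} → IsEdge S e → IsEdge S e′ →
                    ShareEnd e e′ ⇔ (origEnd e ≡ origEnd e′ ⊎ subEnd e ≡ subEnd e′)
    ShareEnd⇔ends {e} {e′} is-e is-e′ = mk⇔ shared common
      where
      crossed : ∀ {d d′} → IsEdge S d → IsEdge S d′ → origEnd d ≢ subEnd d′
      crossed is-d is-d′ eq = proj₂ (end-kinds is-d′) (subst (T ∘ isOrig ∘ label) eq (proj₁ (end-kinds is-d)))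
      shared : ShareEnd e e′ → origEnd e ≡ origEnd e′ ⊎ subEnd e ≡ subEnd e′
      shared sh with ShareEnd⇒common sh
      ... | z , i , i′ with to (Incident⇔ends e) i | to (Incident⇔ends e′) i′
      ...   | inj₁ z≡o | inj₁ z≡o′ = inj₁ (trans (sym z≡o) z≡o′)
      ...   | inj₂ z≡m | inj₂ z≡m′ = inj₂ (trans (sym z≡m) z≡m′)
      ...   | inj₁ z≡o | inj₂ z≡m′ = ⊥-elim (crossed is-e is-e′ (trans (sym z≡o) z≡m′))
      ...   | inj₂ z≡m | inj₁ z≡o′ = ⊥-elim (crossed is-e′ is-e (trans (sym z≡o′) z≡m))
      common : origEnd e ≡ origEnd e′ ⊎ subEnd e ≡ subEnd e′ → ShareEnd e e′
      common (inj₁ o≡o′) =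
        common⇒ShareEnd (from (Incident⇔ends e) (inj₁ refl)) (from (Incident⇔ends e′) (inj₁ o≡o′))
      common (inj₂ m≡m′) =
        common⇒ShareEnd (from (Incident⇔ends e) (inj₂ refl)) (from (Incident⇔ends e′) (inj₂ m≡m′))

    LcAdj⇔meets : ∀ {u v} → IsLcVertex u → IsLcVertex v → u ≢ v → LcAdj u v ⇔ T (meets (code u) (code v))
    LcAdj⇔meets {inj₁ e} {inj₁ e′} is-e is-e′ u≢v =
      mk⇔ (λ (_ , sh) → from T-≟-label-∨ (to (ShareEnd⇔ends is-e is-e′) sh))
          (λ t → (u≢v ∘ cong inj₁) , from (ShareEnd⇔ends is-e is-e′) (to T-≟-label-∨ t))
    LcAdj⇔meets {inj₁ e} {inj₂ c} _ _ _ =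
      ⇔-trans (Incident⇔ends e) (⇔-trans (mk⇔ (map-⊎ sym sym) (map-⊎ sym sym)) (⇔-sym T-≟-label-∨))
    LcAdj⇔meets {inj₂ c} {inj₁ e} _ _ _ = ⇔-trans (Incident⇔ends e) (⇔-sym T-≟-label-∨)
    LcAdj⇔meets {inj₂ _} {inj₂ _} _ _ _ = mk⇔ (λ ()) (λ ())

    adj-π : ∀ x y → adj G x y ≡ modelAdj (π x) (π y)
    adj-π x y with x ≟ᶠ y
    ... | yes refl = trans (Graph.irrefl G x) (cong (λ b → not b ∧ meets (π x) (π x)) (sym (dec-true (π x ≟ᴸ π x) refl)))
    ... | no x≢y = trans
      (T-⇔⇒≡ (⇔-trans (f-adj x y) (LcAdj⇔meets (f-valid x) (f-valid y) (x≢y ∘ f-inj x y))))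
      (cong (λ b → not b ∧ meets (π x) (π y)) (sym (dec-false (π x ≟ᴸ π y) (x≢y ∘ π-injective))))

    coindexM1≡polynomial : coindexM1 G
      ≡ 58 + 74 * l + 28 * l * l + 2 * l * l * l + 48 * k′ + 34 * k′ * l + 2 * k′ * l * l + 8 * k′ * k′
    coindexM1≡polynomial = trans
      (Reindex.coindexM1-coded _≟ᴸ_ enum π π-injective (ModelVertex⇒∈enum ∘ π-valid) (π-onto ∘ ∈enum⇒ModelVertex)
                                (multiplicity≡1 ∘ ∈enum⇒ModelVertex) G modelAdj adj-π)
      coindexᴹ≡polynomial

open Counting using (module LineCutVertex)
open import Data.Integer using (ℤ; +_; _+_; _-_; _*_)
open import Data.Integer.Properties using (pos-+; pos-*)
open import Data.Integer.Tactic.RingSolver using (solve-∀)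
open import Data.Nat.Properties using (m+[n∸m]≡n; m∸n≢0⇒n<m; <⇒≤; <-irrefl)

-- Two-variable polynomials, evaluated in ℕ and in ℤ; ⟦⟧-cast moves the coindex from ℕ to ℤ.
infixl 6 _⊕_
infixl 7 _⊗_

data Poly : Set where
  x₁ x₂   : Poly
  con     : ℕ → Poly
  _⊕_ _⊗_ : Poly → Poly → Poly

⟦_⟧ℕ : Poly → ℕ → ℕ → ℕ
⟦ x₁ ⟧ℕ    a b = a
⟦ x₂ ⟧ℕ    a b = b
⟦ con c ⟧ℕ a b = c
⟦ p ⊕ q ⟧ℕ a b = ⟦ p ⟧ℕ a b ℕ.+ ⟦ q ⟧ℕ a b
⟦ p ⊗ q ⟧ℕ a b = ⟦ p ⟧ℕ a b ℕ.* ⟦ q ⟧ℕ a b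

⟦_⟧ℤ : Poly → ℤ → ℤ → ℤ
⟦ x₁ ⟧ℤ    a b = a
⟦ x₂ ⟧ℤ    a b = b
⟦ con c ⟧ℤ a b = + c
⟦ p ⊕ q ⟧ℤ a b = ⟦ p ⟧ℤ a b + ⟦ q ⟧ℤ a b
⟦ p ⊗ q ⟧ℤ a b = ⟦ p ⟧ℤ a b * ⟦ q ⟧ℤ a b

⟦⟧-cast : ∀ p a b → + ⟦ p ⟧ℕ a b ≡ ⟦ p ⟧ℤ (+ a) (+ b)
⟦⟧-cast x₁      a b = refl
⟦⟧-cast x₂      a b = refl
⟦⟧-cast (con c) a b = refl
⟦⟧-cast (p ⊕ q) a b = trans (pos-+ (⟦ p ⟧ℕ a b) (⟦ q ⟧ℕ a b)) (cong₂ _+_ (⟦⟧-cast p a b) (⟦⟧-cast q a b))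
⟦⟧-cast (p ⊗ q) a b = trans (pos-* (⟦ p ⟧ℕ a b) (⟦ q ⟧ℕ a b)) (cong₂ _*_ (⟦⟧-cast p a b) (⟦⟧-cast q a b))

-- the coindex as a polynomial in k − 3 and n − k
coindexPoly : Poly
coindexPoly = con 58 ⊕ con 74 ⊗ x₂ ⊕ con 28 ⊗ x₂ ⊗ x₂ ⊕ con 2 ⊗ x₂ ⊗ x₂ ⊗ x₂
            ⊕ con 48 ⊗ x₁ ⊕ con 34 ⊗ x₁ ⊗ x₂ ⊕ con 2 ⊗ x₁ ⊗ x₂ ⊗ x₂ ⊕ con 8 ⊗ x₁ ⊗ x₁

coindexFormula : ℤ → ℤ → ℤ
coindexFormula k n = + 2 * n * n * n + (+ 22 - + 4 * k) * n * n
           + (+ 2 * k * k - + 10 * k - + 28) * n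
           - + 4 * k * k + + 28 * k - + 14

coindexPoly≡formula : ∀ a b →
  + 58 + + 74 * b + + 28 * b * b + + 2 * b * b * b + + 48 * a + + 34 * a * b + + 2 * a * b * b + + 8 * a * a
  ≡ + 2 * (+ 3 + a + b) * (+ 3 + a + b) * (+ 3 + a + b) + (+ 22 - + 4 * (+ 3 + a)) * (+ 3 + a + b) * (+ 3 + a + b)
    + (+ 2 * (+ 3 + a) * (+ 3 + a) - + 10 * (+ 3 + a) - + 28) * (+ 3 + a + b)
    - + 4 * (+ 3 + a) * (+ 3 + a) + + 28 * (+ 3 + a) - + 14
coindexPoly≡formula = solve-∀

theorem3p2 : (k n : ℕ) → 3 ≤ k → 1 ≤ n ∸ k →
    {M N : ℕ} (S : Graph M) (G : Graph N) →
    IsSubdivision (CS k (n ∸ k)) S → IsLineCutVertexGraph S G →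
    + coindexM1 G ≡ + 2 * + n * + n * + n + (+ 22 - + 4 * + k) * + n * + n
      + (+ 2 * + k * + k - + 10 * + k - + 28) * + n
      - + 4 * + k * + k + + 28 * + k - + 14
theorem3p2 k@(suc (suc (suc k′))) n (s≤s (s≤s (s≤s z≤n))) 0<l S G IS IL = begin
  + coindexM1 G                        ≡⟨ cong +_ (LineCutVertex.coindexM1≡polynomial k′ l S G 0<l IS IL) ⟩
  + ⟦ coindexPoly ⟧ℕ k′ l              ≡⟨ ⟦⟧-cast coindexPoly k′ l ⟩
  ⟦ coindexPoly ⟧ℤ (+ k′) (+ l)        ≡⟨ coindexPoly≡formula (+ k′) (+ l) ⟩
  coindexFormula (+ 3 + + k′) (+ 3 + + k′ + + l) ≡⟨ cong₂ coindexFormula (sym (pos-+ 3 k′)) (sym n≡) ⟩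
  coindexFormula (+ k) (+ n)                   ∎
  where
  open ≡-Reasoning
  l = n ∸ k
  n≡ : + n ≡ + 3 + + k′ + + l
  n≡ = trans (cong +_ (sym (m+[n∸m]≡n {k} (<⇒≤ (m∸n≢0⇒n<m (λ l≡0 → <-irrefl (sym l≡0) 0<l))))))
             (trans (pos-+ k l) (cong (_+ + l) (pos-+ 3 k′)))
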